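{- Let $\mathcal{P}$ be a hereditary property of ordered graphs and $k\in\mathbb{N}$, and suppose that there are ordered graphs $G\in\mathcal{P}$ for which $t_{k+1}$, the size of the $(k+1)$-st largest homogeneous block of $G$, is arbitrarily large. Then $|\mathcal{P}_n|\geqslant\binom{n-3k-2}{k}=n^k/k!+O(n^{k-1})$ as $n\to\infty$; moreover, if $k=1$ then $|\mathcal{P}_n|\geqslant n$ for every $n\in\mathbb{N}$.
   Context: An ordered graph of order $n$ is a graph on vertex set $[n]$ with the natural order; a hereditary property of ordered graphs is a class closed under order-preserving isomorphism and induced ordered subgraphs; $\mathcal{P}_n=\{G\in\mathcal{P}:V(G)=[n]\}$. A homogeneous block of $G$ is a maximal set $B$ of consecutive vertices such that $\Gamma(x)\setminus\{y\}=\Gamma(y)\setminus\{x\}$ for all $x,y\in B$. The homogeneous block sequence $t_1\geqslant t_2\geqslant\cdots$ lists the sizes of the homogeneous blocks in non-increasing order, followed by zeros. -}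

module Defs where

open import Data.Nat using (ℕ; zero; suc; _+_; _*_; _∸_; _^_; _≤_; _<_; _!)
open import Data.Nat.Combinatorics using (_C_)
open import Data.Fin using (Fin; toℕ)
open import Data.Bool using (Bool; false)
open import Data.Product using (Σ; ∃; _×_; _,_)
open import Relation.Binary.PropositionalEquality using (_≡_; _≢_)
open import Relation.Nullary using (¬_)

-- An ordered graph of order n: a simple graph on vertex set Fin n ≅ [n]
-- (vertex i of Fin n is vertex i+1 of [n]); the order is the order of Fin n.
record OGraph (n : ℕ) : Set where
  field
    adj   : Fin n → Fin n → Bool
    sym   : ∀ x y → adj x y ≡ adj y x
    irrefl : ∀ x → adj x x ≡ false
open OGraph public

_≈G_ : ∀ {n} → OGraph n → OGraph n → Set
G ≈G H = ∀ x y → adj G x y ≡ adj H x y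

StrictlyIncreasing : ∀ {m n} → (Fin m → Fin n) → Set
StrictlyIncreasing {m} f = ∀ (i j : Fin m) → toℕ i < toℕ j → toℕ (f i) < toℕ (f j)

induced : ∀ {m n} → OGraph n → (f : Fin m → Fin n) → StrictlyIncreasing f → OGraph m
induced G f inc = record
  { adj = λ i j → adj G (f i) (f j)
  ; sym = λ i j → sym G (f i) (f j)
  ; irrefl = λ i → irrefl G (f i) }

Property : Set₁
Property = ∀ {n} → OGraph n → Set

-- Hereditary: closed under (order-preserving) isomorphism and induced ordered
-- subgraphs. (Order-preserving isomorphisms between graphs on [n] are the
-- identity, so closure under isomorphism is closure under ≈G.)
Hereditary : Property → Set
Hereditary P =
  (∀ {n} (G H : OGraph n) → G ≈G H → P G → P H) ×
  (∀ {m n} (G : OGraph n) (f : Fin m → Fin n) (inc : StrictlyIncreasing f) →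
     P G → P (induced G f inc))

-- |P_n| ≥ m : there are m pairwise distinct graphs in P_n.
AtLeast : Property → ℕ → ℕ → Set
AtLeast P n m = Σ (Fin m → OGraph n) λ g →
  (∀ i → P (g i)) × (∀ i j → i ≢ j → ¬ (g i ≈G g j))

InInterval : ∀ {n} → ℕ → ℕ → Fin n → Set
InInterval a len x = a ≤ toℕ x × toℕ x < a + len

-- Homogeneous set of consecutive vertices: Γ(x)∖{y} = Γ(y)∖{x} for x,y in it,
-- written out: for every z ∉ {x,y}, z ∼ x iff z ∼ y (for z ∈ {x,y} both sides
-- are automatically false by irreflexivity).
HomInterval : ∀ {n} → OGraph n → ℕ → ℕ → Set
HomInterval {n} G a len =
  a + len ≤ n ×
  (∀ x y → InInterval a len x → InInterval a len y →
     ∀ z → z ≢ x → z ≢ y → adj G x z ≡ adj G y z)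

HomBlock : ∀ {n} → OGraph n → ℕ → ℕ → Set
HomBlock G a len =
  0 < len × HomInterval G a len ×
  (∀ a' len' → HomInterval G a' len' → a' ≤ a → a + len ≤ a' + len' →
     (a' ≡ a × len' ≡ len))

-- t_{k+1}(G) ≥ M : G has at least k+1 distinct homogeneous blocks of size ≥ M.
tGeq : ∀ {n} → OGraph n → ℕ → ℕ → Set
tGeq G k M = Σ (Fin (suc k) → ℕ × ℕ) λ b →
  (∀ i j → b i ≡ b j → i ≡ j) ×
  (∀ i → let (a , len) = b i in HomBlock G a len × M ≤ len)

module Submission where

-- Take G ∈ P with k+1 homogeneous blocks of size ≥ n+3 and let D be the rightmost
-- one. Each other block B_t is maximal, so the vertex r_t just after it is not a
-- twin of B_t: some vertex z_t sees r_t and B_t differently. For a k-tuple c with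
-- Σ c ≤ n − 4k − 2, induce G on the first c_t + 2 vertices of each B_t together
-- with r_t and z_t, padded to n vertices by an initial segment of D; there are
-- C(n − 3k − 2, k) such tuples. If c and c' first differ (in the order of the
-- blocks) at t, with c_t < c'_t, let x be the last vertex of B_t selected by c.
-- The selections agree below x, so x has the same position p in both graphs,
-- and at position p+1 one graph has r_t, which z_t separates from x, while the
-- other has a twin of x. So the graphs are distinct.
-- For k = 1, a case analysis on how B, D, r and z are joined yields n layouts
-- (initial segments of B and D and at most two single vertices) whose induced
-- graphs are pairwise distinct.

open import Defs hiding (sym)
open import Data.Bool using (Bool; true; false; _∨_)
open import Data.Bool.Properties using () renaming (_≟_ to _≟B_)
open import Data.Empty using (⊥; ⊥-elim)
open import Data.Fin using (Fin; toℕ; fromℕ<; splitAt; join; punchIn) renaming (zero to fz; suc to fs)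
open import Data.Fin.Properties
  using (toℕ-injective; toℕ<n; fromℕ<-toℕ; toℕ-fromℕ<; join-splitAt; punchIn-injective; punchInᵢ≢i; any?; ¬∀⟶∃¬)
  renaming (_≟_ to _≟F_)
open import Data.List using (List; []; _∷_)
open import Data.Nat using (ℕ; zero; suc; _+_; _*_; _∸_; _^_; _≤_; _<_; _!; z≤n; s≤s; s≤s⁻¹)
open import Data.Nat.Combinatorics using (_C_; nCk≡nPk/k!; nCn≡1; nCk+nC[k+1]≡[n+1]C[k+1])
open import Data.Nat.Combinatorics.Base using (_P′_)
import Data.Nat.Combinatorics.Base as Comb
open import Data.Nat.Combinatorics.Specification using (k!∣nP′k; nP′k≡n!/[n∸k]!; nPk≡n!/[n∸k]!; k>n⇒nCk≡0)
open import Data.Nat.DivMod using (_/_; m*[n/m]≡n)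
open import Data.Nat.Properties
open import Algebra.Properties.CommutativeSemigroup *-commutativeSemigroup using (x∙yz≈y∙xz)
open import Data.Nat.Solver using (module +-*-Solver)
open import Data.Product using (Σ; ∃; _×_; _,_; proj₁; proj₂)
open import Data.Product.Properties using (×-≡,≡→≡)
open import Data.Sum using (_⊎_; inj₁; inj₂)
open import Data.Unit using (⊤; tt)
open import Relation.Binary.Definitions using (tri<; tri≈; tri>; Tri)
open import Relation.Binary.PropositionalEquality
open import Relation.Nullary using (¬_; Dec; yes; no)
open import Relation.Nullary.Decidable using (⌊_⌋; ¬?; _×-dec_; decidable-stable)

-- Asymptotics of binomial coefficients

n*[k*A*n^[k∸1]]≡k*A*n^k : ∀ n A k → n * (k * A * n ^ (k ∸ 1)) ≡ k * A * n ^ k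
n*[k*A*n^[k∸1]]≡k*A*n^k n A zero = *-zeroʳ n
n*[k*A*n^[k∸1]]≡k*A*n^k n A (suc k) = x∙yz≈y∙xz n (suc k * A) (n ^ k)

n^k≤[n∸A]^k+k*A*n^[k∸1] : ∀ n A k → n ^ k ≤ (n ∸ A) ^ k + k * A * n ^ (k ∸ 1)
n^k≤[n∸A]^k+k*A*n^[k∸1] n A zero = ≤-refl
n^k≤[n∸A]^k+k*A*n^[k∸1] n A (suc k) = begin
  n * n ^ k                                              ≤⟨ *-monoʳ-≤ n (n^k≤[n∸A]^k+k*A*n^[k∸1] n A k) ⟩
  n * ((n ∸ A) ^ k + k * A * n ^ (k ∸ 1))                ≡⟨ *-distribˡ-+ n ((n ∸ A) ^ k) _ ⟩
  n * (n ∸ A) ^ k + n * (k * A * n ^ (k ∸ 1))            ≡⟨ cong (n * (n ∸ A) ^ k +_) (n*[k*A*n^[k∸1]]≡k*A*n^k n A k) ⟩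
  n * (n ∸ A) ^ k + k * A * n ^ k                        ≤⟨ +-monoˡ-≤ (k * A * n ^ k) n*[n∸A]^k≤ ⟩
  ((n ∸ A) * (n ∸ A) ^ k + A * n ^ k) + k * A * n ^ k    ≡⟨ +-assoc ((n ∸ A) * (n ∸ A) ^ k) (A * n ^ k) _ ⟩
  (n ∸ A) * (n ∸ A) ^ k + (A * n ^ k + k * A * n ^ k)    ≡⟨ cong ((n ∸ A) * (n ∸ A) ^ k +_) (*-distribʳ-+ (n ^ k) A (k * A)) ⟨
  (n ∸ A) * (n ∸ A) ^ k + (A + k * A) * n ^ k            ∎
  where
  open ≤-Reasoning
  n*[n∸A]^k≤ : n * (n ∸ A) ^ k ≤ (n ∸ A) * (n ∸ A) ^ k + A * n ^ k
  n*[n∸A]^k≤ = begin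
    n * (n ∸ A) ^ k                          ≤⟨ *-monoˡ-≤ ((n ∸ A) ^ k) (≤-trans (m≤n+m∸n n A) (≤-reflexive (+-comm A (n ∸ A)))) ⟩
    (n ∸ A + A) * (n ∸ A) ^ k                ≡⟨ *-distribʳ-+ ((n ∸ A) ^ k) (n ∸ A) A ⟩
    (n ∸ A) * (n ∸ A) ^ k + A * (n ∸ A) ^ k  ≤⟨ +-monoʳ-≤ ((n ∸ A) * (n ∸ A) ^ k) (*-monoʳ-≤ A (^-monoˡ-≤ k (m∸n≤m n A))) ⟩
    (n ∸ A) * (n ∸ A) ^ k + A * n ^ k        ∎

nP′k≤n^k : ∀ n k → n P′ k ≤ n ^ k
nP′k≤n^k n zero = ≤-refl
nP′k≤n^k n (suc k) = *-mono-≤ (m∸n≤m n k) (nP′k≤n^k n k)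

[n∸k]^k≤nP′k : ∀ n k → (n ∸ k) ^ k ≤ n P′ k
[n∸k]^k≤nP′k n zero = ≤-refl
[n∸k]^k≤nP′k n (suc k) = *-mono-≤ (∸-monoʳ-≤ n (n≤1+n k))
  (≤-trans (^-monoˡ-≤ k (∸-monoʳ-≤ n (n≤1+n k))) ([n∸k]^k≤nP′k n k))

k!*nCk≡nP′k : ∀ n k → k ≤ n → k ! * (n C k) ≡ n P′ k
k!*nCk≡nP′k n k k≤n = trans (cong (k ! *_) (nCk≡nPk/k! k≤n))
  (trans (cong (λ x → k ! * (x / k !)) nPk≡nP′k) (m*[n/m]≡n (k!∣nP′k k≤n)))
  where
  instance _ = k !≢0
  nPk≡nP′k : Comb._P_ n k ≡ n P′ k
  nPk≡nP′k = trans (nPk≡n!/[n∸k]! k≤n) (sym (nP′k≡n!/[n∸k]! k≤n))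

k!*[n∸A]Ck≈n^k : ∀ A k → Σ ℕ λ c → Σ ℕ λ N → ∀ n → N ≤ n →
  (n ^ k ≤ k ! * ((n ∸ A) C k) + c * n ^ (k ∸ 1)) × (k ! * ((n ∸ A) C k) ≤ n ^ k + c * n ^ (k ∸ 1))
k!*[n∸A]Ck≈n^k A k = k * (A + k) , A + k , λ n A+k≤n → lower n A+k≤n , upper n A+k≤n
  where
  open ≤-Reasoning
  module _ (n : ℕ) (A+k≤n : A + k ≤ n) where
    m : ℕ
    m = n ∸ A
    E : ℕ
    E = k * (A + k) * n ^ (k ∸ 1)
    k!*mCk≡mP′k : k ! * (m C k) ≡ m P′ k
    k!*mCk≡mP′k = k!*nCk≡nP′k m k (≤-trans (≤-reflexive (sym (m+n∸m≡n A k))) (∸-monoˡ-≤ A A+k≤n))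

    lower : n ^ k ≤ k ! * (m C k) + E
    lower = begin
      n ^ k                    ≤⟨ n^k≤[n∸A]^k+k*A*n^[k∸1] n (A + k) k ⟩
      (n ∸ (A + k)) ^ k + E    ≡⟨ cong (λ x → x ^ k + E) (∸-+-assoc n A k) ⟨
      (m ∸ k) ^ k + E          ≤⟨ +-monoˡ-≤ E ([n∸k]^k≤nP′k m k) ⟩
      m P′ k + E               ≡⟨ cong (_+ E) k!*mCk≡mP′k ⟨
      k ! * (m C k) + E        ∎

    upper : k ! * (m C k) ≤ n ^ k + E
    upper = begin
      k ! * (m C k)            ≡⟨ k!*mCk≡mP′k ⟩
      m P′ k                   ≤⟨ nP′k≤n^k m k ⟩
      m ^ k                    ≤⟨ ^-monoˡ-≤ k (m∸n≤m n A) ⟩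
      n ^ k                    ≤⟨ m≤m+n (n ^ k) E ⟩
      n ^ k + E                ∎

-- Homogeneous intervals and blocks

-- Vertices are handled as natural numbers; adjacency is false outside [0, N).
adjℕ : ∀ {N} → OGraph N → ℕ → ℕ → Bool
adjℕ {N} G u v with u <? N | v <? N
... | yes p | yes q = adj G (fromℕ< p) (fromℕ< q)
... | yes _ | no _ = false
... | no _ | _ = false

adjℕ-fromℕ< : ∀ {N} (G : OGraph N) u v (p : u < N) (q : v < N) → adjℕ G u v ≡ adj G (fromℕ< p) (fromℕ< q)
adjℕ-fromℕ< {N} G u v p q with u <? N | v <? N
... | yes _ | yes _ = refl
... | yes _ | no ¬q = ⊥-elim (¬q q)
... | no ¬p | _ = ⊥-elim (¬p p)

adjℕ-outʳ : ∀ {N} (G : OGraph N) u v → N ≤ v → adjℕ G u v ≡ false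
adjℕ-outʳ {N} G u v le with u <? N | v <? N
... | yes _ | yes q = ⊥-elim (<⇒≱ q le)
... | yes _ | no _ = refl
... | no _ | _ = refl

adjℕ-outˡ : ∀ {N} (G : OGraph N) u v → N ≤ u → adjℕ G u v ≡ false
adjℕ-outˡ {N} G u v le with u <? N | v <? N
... | yes p | yes q = ⊥-elim (<⇒≱ p le)
... | yes _ | no _ = refl
... | no _ | _ = refl

adjℕ-toℕ : ∀ {N} (G : OGraph N) x y → adjℕ G (toℕ x) (toℕ y) ≡ adj G x y
adjℕ-toℕ G x y = trans (adjℕ-fromℕ< G (toℕ x) (toℕ y) (toℕ<n x) (toℕ<n y))
  (cong₂ (adj G) (fromℕ<-toℕ x _) (fromℕ<-toℕ y _))

adjℕ-sym : ∀ {N} (G : OGraph N) u v → adjℕ G u v ≡ adjℕ G v u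
adjℕ-sym {N} G u v = go (u <? N) (v <? N)
  where
  go : Dec (u < N) → Dec (v < N) → adjℕ G u v ≡ adjℕ G v u
  go (yes p) (yes q) = trans (adjℕ-fromℕ< G u v p q) (trans (OGraph.sym G _ _) (sym (adjℕ-fromℕ< G v u q p)))
  go (yes p) (no q) = trans (adjℕ-outʳ G u v (≮⇒≥ q)) (sym (adjℕ-outˡ G v u (≮⇒≥ q)))
  go (no p) _ = trans (adjℕ-outˡ G u v (≮⇒≥ p)) (sym (adjℕ-outʳ G v u (≮⇒≥ p)))

Within : ℕ → ℕ → ℕ → Set
Within a len x = a ≤ x × x < a + len

hom-adjℕ : ∀ {N} (G : OGraph N) a len → HomInterval G a len →
  ∀ x y z → Within a len x → Within a len y → z ≢ x → z ≢ y → adjℕ G x z ≡ adjℕ G y z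
hom-adjℕ {N} G a len (bound , H) x y z (ax , xb) (ay , yb) zx zy = go (z <? N)
  where
  x< : x < N
  x< = <-≤-trans xb bound
  y< : y < N
  y< = <-≤-trans yb bound
  X : Fin N
  X = fromℕ< x<
  Y : Fin N
  Y = fromℕ< y<
  tx : toℕ X ≡ x
  tx = toℕ-fromℕ< x<
  ty : toℕ Y ≡ y
  ty = toℕ-fromℕ< y<
  go : Dec (z < N) → adjℕ G x z ≡ adjℕ G y z
  go (no z≥) = trans (adjℕ-outʳ G x z (≮⇒≥ z≥)) (sym (adjℕ-outʳ G y z (≮⇒≥ z≥)))
  go (yes z<) =
   trans (adjℕ-fromℕ< G x z x< z<)
   (trans (H X Y (subst (a ≤_) (sym tx) ax , subst (_< a + len) (sym tx) xb)
                 (subst (a ≤_) (sym ty) ay , subst (_< a + len) (sym ty) yb)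
                 (fromℕ< z<) (λ e → zx (trans (sym (toℕ-fromℕ< z<)) (trans (cong toℕ e) tx)))
                   (λ e → zy (trans (sym (toℕ-fromℕ< z<)) (trans (cong toℕ e) ty))))
     (sym (adjℕ-fromℕ< G y z y< z<)))

homInterval-fromℕ : ∀ {N} (G : OGraph N) a len → a + len ≤ N →
  (∀ x y z → Within a len x → Within a len y → z ≢ x → z ≢ y → z < N → adjℕ G x z ≡ adjℕ G y z) →
  HomInterval G a len
homInterval-fromℕ G a len bnd h = bnd , λ x y (ax , xb) (ay , yb) z zx zy →
  trans (sym (adjℕ-toℕ G x z))
   (trans (h (toℕ x) (toℕ y) (toℕ z) (ax , xb) (ay , yb)
            (λ e → zx (toℕ-injective e)) (λ e → zy (toℕ-injective e)) (toℕ<n z))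
     (adjℕ-toℕ G y z))

hom-pairs : ∀ {N} (G : OGraph N) a len → HomInterval G a len →
  ∀ x y x' y' → Within a len x → Within a len y → Within a len x' → Within a len y' →
  x ≢ y → x' ≢ y' → adjℕ G x y ≡ adjℕ G x' y'
hom-pairs G a len H x y x' y' ix iy ix' iy' xy x'y' with x' ≟ y
... | no x'≢y = trans (hom-adjℕ G a len H x x' y ix ix' (λ e → xy (sym e)) (λ e → x'≢y (sym e)))
                  (trans (adjℕ-sym G x' y)
                   (trans (hom-adjℕ G a len H y y' x' iy iy' x'≢y x'y')
                     (adjℕ-sym G y' x')))
... | yes refl = trans (hom-adjℕ G a len H x y' x' ix iy' (λ e → xy (sym e)) x'y') (adjℕ-sym G y' x')

homInterval-∪ : ∀ {N} (G : OGraph N) a1 l1 a2 l2 → HomInterval G a1 l1 → HomInterval G a2 l2 →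
  a1 ≤ a2 → a2 < a1 + l1 → a1 + l1 ≤ a2 + l2 → HomInterval G a1 (a2 + l2 ∸ a1)
homInterval-∪ {N} G a1 l1 a2 l2 H1 H2 a1≤a2 a2<e1 e1≤e2 =
  homInterval-fromℕ G a1 (a2 + l2 ∸ a1) (≤-trans (≤-reflexive (m+[n∸m]≡n a1≤e2)) (proj₁ H2)) main
  where
  a1≤e2 : a1 ≤ a2 + l2
  a1≤e2 = ≤-trans a1≤a2 (m≤m+n a2 l2)
  e2eq : a1 + (a2 + l2 ∸ a1) ≡ a2 + l2
  e2eq = m+[n∸m]≡n a1≤e2
  wI1 : Within a1 l1 a2
  wI1 = a1≤a2 , a2<e1
  wI2 : Within a2 l2 a2
  wI2 = ≤-refl , <-≤-trans a2<e1 e1≤e2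
  cls : ∀ u → Within a1 (a2 + l2 ∸ a1) u → Within a1 l1 u ⊎ Within a2 l2 u
  cls u (a1≤u , u<) with u <? a1 + l1
  ... | yes u<e1 = inj₁ (a1≤u , u<e1)
  ... | no u≥e1 = inj₂ (≤-trans (<⇒≤ a2<e1) (≮⇒≥ u≥e1) , subst (u <_) e2eq u<)
  toW : ∀ u z → (Within a1 l1 u ⊎ Within a2 l2 u) → z ≢ u → z ≢ a2 → adjℕ G u z ≡ adjℕ G a2 z
  toW u z (inj₁ iu) zu zw = hom-adjℕ G a1 l1 H1 u a2 z iu wI1 zu zw
  toW u z (inj₂ iu) zu zw = hom-adjℕ G a2 l2 H2 u a2 z iu wI2 zu zw
  cross : ∀ x y → Within a1 l1 x → Within a2 l2 y → a2 ≢ x → a2 ≢ y → x ≢ y → adjℕ G x a2 ≡ adjℕ G y a2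
  cross x y ix iy wx wy xy =
    trans (adjℕ-sym G x a2)
     (trans (hom-adjℕ G a2 l2 H2 a2 y x wI2 iy (λ e → wx (sym e)) xy)
      (trans (adjℕ-sym G y x)
       (trans (hom-adjℕ G a1 l1 H1 x a2 y ix wI1 (λ e → xy (sym e)) (λ e → wy (sym e)))
         (adjℕ-sym G a2 y))))
  main : ∀ x y z → Within a1 (a2 + l2 ∸ a1) x → Within a1 (a2 + l2 ∸ a1) y → z ≢ x → z ≢ y → z < N → adjℕ G x z ≡ adjℕ G y z
  main x y z ix iy zx zy _ with z ≟ a2
  ... | no zw = trans (toW x z (cls x ix) zx zw) (sym (toW y z (cls y iy) zy zw))
  ... | yes refl with cls x ix | cls y iy | x ≟ y
  ...   | _ | _ | yes refl = refl
  ...   | inj₁ jx | inj₁ jy | no _ = hom-adjℕ G a1 l1 H1 x y z jx jy zx zy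
  ...   | inj₂ jx | inj₂ jy | no _ = hom-adjℕ G a2 l2 H2 x y z jx jy zx zy
  ...   | inj₁ jx | inj₂ jy | no xy = cross x y jx jy zx zy xy
  ...   | inj₂ jx | inj₁ jy | no xy = sym (cross y x jy jx zy zx (λ e → xy (sym e)))

blocks-disjoint-≤ : ∀ {N} (G : OGraph N) a1 l1 a2 l2 → HomBlock G a1 l1 → HomBlock G a2 l2 →
  ¬ (a1 ≡ a2 × l1 ≡ l2) → a1 ≤ a2 → ∀ v → Within a1 l1 v → Within a2 l2 v → ⊥
blocks-disjoint-≤ G a1 l1 a2 l2 (_ , H1 , M1) (_ , H2 , M2) ne a1≤a2 v (_ , v<e1) (a2≤v , _)
  with a2 + l2 ≤? a1 + l1
... | yes e2≤e1 = ne (M2 a1 l1 H1 a1≤a2 e2≤e1)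
... | no e2>e1 = <-irrefl eq (≰⇒> e2>e1)
  where
  e1≤e2 : a1 + l1 ≤ a2 + l2
  e1≤e2 = <⇒≤ (≰⇒> e2>e1)
  a1≤e2 : a1 ≤ a2 + l2
  a1≤e2 = ≤-trans a1≤a2 (m≤m+n a2 l2)
  U : HomInterval G a1 (a2 + l2 ∸ a1)
  U = homInterval-∪ G a1 l1 a2 l2 H1 H2 a1≤a2 (≤-<-trans a2≤v v<e1) e1≤e2
  eq : a1 + l1 ≡ a2 + l2
  eq = trans (cong (a1 +_) (sym (proj₂ (M1 a1 (a2 + l2 ∸ a1) U ≤-refl
              (≤-trans e1≤e2 (≤-reflexive (sym (m+[n∸m]≡n a1≤e2)))))))) (m+[n∸m]≡n a1≤e2)

blocks-disjoint : ∀ {N} (G : OGraph N) a1 l1 a2 l2 → HomBlock G a1 l1 → HomBlock G a2 l2 →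
  ¬ (a1 ≡ a2 × l1 ≡ l2) → ∀ v → Within a1 l1 v → Within a2 l2 v → ⊥
blocks-disjoint G a1 l1 a2 l2 B1 B2 ne v i1 i2 with ≤-total a1 a2
... | inj₁ le = blocks-disjoint-≤ G a1 l1 a2 l2 B1 B2 ne le v i1 i2
... | inj₂ le = blocks-disjoint-≤ G a2 l2 a1 l1 B2 B1 (λ { (e1 , e2) → ne (sym e1 , sym e2) }) le v i2 i1

block-start : ∀ {N} (G : OGraph N) a l → HomBlock G a l → Within a l a
block-start G a l (0<l , _) = ≤-refl , ≤-trans (≤-reflexive (+-comm 1 a)) (+-monoʳ-≤ a 0<l)

block-ends-before : ∀ {N} (G : OGraph N) a1 l1 a2 l2 → HomBlock G a1 l1 → HomBlock G a2 l2 →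
  a1 < a2 → a1 + l1 ≤ a2
block-ends-before G a1 l1 a2 l2 B1 B2 a1<a2 with a1 + l1 ≤? a2
... | yes le = le
... | no gt = ⊥-elim (blocks-disjoint G a1 l1 a2 l2 B1 B2 (λ { (e , _) → <-irrefl e a1<a2 })
                 a2 (<⇒≤ a1<a2 , ≰⇒> gt) (block-start G a2 l2 B2))

-- Selecting vertices

within? : ∀ a l u → Dec (Within a l u)
within? a l u = (a ≤? u) ×-dec (u <? a + l)

withinᵇ : ℕ → ℕ → ℕ → Bool
withinᵇ a m u = ⌊ within? a m u ⌋

withinᵇ-true : ∀ a m u → Within a m u → withinᵇ a m u ≡ true
withinᵇ-true a m u h with within? a m u
... | yes _ = refl
... | no nh = ⊥-elim (nh h)

withinᵇ-false : ∀ a m u → ¬ Within a m u → withinᵇ a m u ≡ false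
withinᵇ-false a m u h with within? a m u
... | yes y = ⊥-elim (h y)
... | no _ = refl

withinᵇ-sound : ∀ a m u → withinᵇ a m u ≡ true → Within a m u
withinᵇ-sound a m u e with within? a m u
... | yes y = y
withinᵇ-sound a m u () | no _

isᵇ : ℕ → ℕ → Bool
isᵇ w u = ⌊ u ≟ w ⌋

isᵇ-refl : ∀ w → isᵇ w w ≡ true
isᵇ-refl w with w ≟ w
... | yes _ = refl
... | no ne = ⊥-elim (ne refl)

isᵇ-false : ∀ w u → u ≢ w → isᵇ w u ≡ false
isᵇ-false w u ne with u ≟ w
... | yes e = ⊥-elim (ne e)
... | no _ = refl

isᵇ-sound : ∀ w u → isᵇ w u ≡ true → u ≡ w
isᵇ-sound w u e with u ≟ w
... | yes y = y
isᵇ-sound w u () | no _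

∨-trueˡ : ∀ x y → x ≡ true → x ∨ y ≡ true
∨-trueˡ x y refl = refl

∨-trueʳ : ∀ x y → y ≡ true → x ∨ y ≡ true
∨-trueʳ true y e = refl
∨-trueʳ false y e = e

∨-false : ∀ x y → x ≡ false → y ≡ false → x ∨ y ≡ false
∨-false x y refl refl = refl

isᵇ-within : ∀ w u → isᵇ w u ≡ true → w ≤ u × u < w + 1
isᵇ-within w u e rewrite isᵇ-sound w u e = ≤-refl , ≤-reflexive (+-comm 1 w)

withinᵇ-suc : ∀ a m u → u ≢ a + m → withinᵇ a (suc m) u ≡ withinᵇ a m u
withinᵇ-suc a m u ne with within? a (suc m) u | within? a m u
... | yes _ | yes _ = refl
... | no _ | no _ = refl
... | yes (h1 , h2) | no nh = ⊥-elim (nh (h1 , ≤∧≢⇒< (s≤s⁻¹ (subst (u <_) (+-suc a m) h2)) ne))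
... | no nh | yes (h1 , h2) = ⊥-elim (nh (h1 , <-trans h2 (+-monoʳ-< a (n<1+n m))))

withinᵇ-agree : ∀ a m m' u → u < a + m → u < a + m' → withinᵇ a m u ≡ withinᵇ a m' u
withinᵇ-agree a m m' u h h' with within? a m u | within? a m' u
... | yes _ | yes _ = refl
... | no _ | no _ = refl
... | yes (p , _) | no nh = ⊥-elim (nh (p , h'))
... | no nh | yes (p , _) = ⊥-elim (nh (p , h))

bit : Bool → ℕ
bit true = 1
bit false = 0

-- rank s v counts the selected vertices below v; the selected vertex of rank p
-- becomes vertex p of the induced graph.
rank : (ℕ → Bool) → ℕ → ℕ
rank s zero = 0
rank s (suc v) = rank s v + bit (s v)

bit≤1 : ∀ b → bit b ≤ 1
bit≤1 true = ≤-refl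
bit≤1 false = z≤n

rank-step : ∀ s v → rank s v ≤ rank s (suc v)
rank-step s v = m≤m+n (rank s v) _

rank-mono : ∀ s {u v} → u ≤ v → rank s u ≤ rank s v
rank-mono s {u} {zero} z≤n = ≤-refl
rank-mono s {u} {suc v} le with m≤n⇒m<n∨m≡n le
... | inj₂ refl = ≤-refl
... | inj₁ lt = ≤-trans (rank-mono s (s≤s⁻¹ lt)) (rank-step s v)

rank-true : ∀ s u → s u ≡ true → rank s (suc u) ≡ suc (rank s u)
rank-true s u e rewrite e = +-comm (rank s u) 1

rank-false : ∀ s u → s u ≡ false → rank s (suc u) ≡ rank s u
rank-false s u e rewrite e = +-identityʳ (rank s u)

rank-strict : ∀ s {u v} → s u ≡ true → u < v → rank s u < rank s v
rank-strict s {u} e lt = ≤-trans (≤-reflexive (sym (rank-true s u e))) (rank-mono s lt)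

rank-inj : ∀ s {u v} → s u ≡ true → s v ≡ true → rank s u ≡ rank s v → u ≡ v
rank-inj s {u} {v} su sv eq with <-cmp u v
... | tri< lt _ _ = ⊥-elim (<-irrefl eq (rank-strict s su lt))
... | tri≈ _ e _ = e
... | tri> _ _ gt = ⊥-elim (<-irrefl (sym eq) (rank-strict s sv gt))

rank-ext : ∀ s t V → (∀ u → u < V → s u ≡ t u) → rank s V ≡ rank t V
rank-ext s t zero h = refl
rank-ext s t (suc V) h = cong₂ _+_ (rank-ext s t V (λ u lt → h u (m<n⇒m<1+n lt))) (cong bit (h V ≤-refl))

rank-skip : ∀ s V W → V ≤ W → (∀ u → V ≤ u → u < W → s u ≡ false) → rank s W ≡ rank s V
rank-skip s V zero z≤n h = refl
rank-skip s V (suc W) le h with m≤n⇒m<n∨m≡n le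
... | inj₂ refl = refl
... | inj₁ lt = trans (rank-false s W (h W (s≤s⁻¹ lt) ≤-refl))
                  (rank-skip s V W (s≤s⁻¹ lt) (λ u a b → h u a (m<n⇒m<1+n b)))

rank-exists : ∀ s V p → p < rank s V → Σ ℕ λ v → v < V × s v ≡ true × rank s v ≡ p
rank-exists s zero p ()
rank-exists s (suc V) p lt with p <? rank s V
... | yes lt' = let (v , a , b , c) = rank-exists s V p lt' in v , m<n⇒m<1+n a , b , c
... | no ge with s V in eq
...   | true = V , ≤-refl , eq , ≤-antisym (≮⇒≥ ge) (s≤s⁻¹ (≤-trans lt (≤-reflexive (+-comm (rank s V) 1))))
...   | false = ⊥-elim (ge (≤-trans lt (≤-reflexive (+-identityʳ (rank s V)))))

bit-∨ : ∀ a b → bit (a ∨ b) ≤ bit a + bit b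
bit-∨ true b = s≤s z≤n
bit-∨ false b = ≤-refl

rank-∨ : ∀ s t V → rank (λ u → s u ∨ t u) V ≤ rank s V + rank t V
rank-∨ s t zero = z≤n
rank-∨ s t (suc V) = ≤-trans (+-mono-≤ (rank-∨ s t V) (bit-∨ (s V) (t V)))
  (≤-reflexive (+-assoc-swap (rank s V) (rank t V) (bit (s V)) (bit (t V))))
  where
  +-assoc-swap : ∀ a b c d → (a + b) + (c + d) ≡ (a + c) + (b + d)
  +-assoc-swap a b c d = trans (+-assoc a b (c + d)) (trans (cong (a +_) (trans (sym (+-assoc b c d))
     (trans (cong (_+ d) (+-comm b c)) (+-assoc c b d)))) (sym (+-assoc a c (b + d))))

rank-below : ∀ s a W → (∀ u → u < a → s u ≡ false) → rank s W ≤ W ∸ a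
rank-below s a zero h = z≤n
rank-below s a (suc W) h with W <? a
... | yes lt = ≤-trans (≤-reflexive (rank-false s W (h W lt))) (≤-trans (rank-below s a W h) (∸-monoˡ-≤ a (n≤1+n W)))
... | no ge = ≤-trans (+-mono-≤ (rank-below s a W h) (bit≤1 (s W)))
               (≤-reflexive (trans (+-comm (W ∸ a) 1) (sym (+-∸-assoc 1 (≮⇒≥ ge)))))

rank-above : ∀ s c W → (∀ u → c ≤ u → s u ≡ false) → rank s W ≤ rank s c
rank-above s c W h with W ≤? c
... | yes le = rank-mono s le
... | no gt = ≤-reflexive (rank-skip s c W (<⇒≤ (≰⇒> gt)) (λ u a _ → h u a))

rank-interval : ∀ s a m W → (∀ u → s u ≡ true → a ≤ u × u < a + m) → rank s W ≤ m
rank-interval s a m W h = ≤-trans (rank-above s (a + m) W above)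
   (≤-trans (rank-below s a (a + m) below) (≤-reflexive (m+n∸m≡n a m)))
  where
  above : ∀ u → a + m ≤ u → s u ≡ false
  above u le with s u in e
  ... | true = ⊥-elim (<⇒≱ (proj₂ (h u e)) le)
  ... | false = refl
  below : ∀ u → u < a → s u ≡ false
  below u lt with s u in e
  ... | true = ⊥-elim (<⇒≱ lt (proj₁ (h u e)))
  ... | false = refl

anyF : ∀ {K} → (Fin K → Bool) → Bool
anyF {zero} f = false
anyF {suc K} f = f fz ∨ anyF (λ t → f (fs t))

sumF : ∀ {K} → (Fin K → ℕ) → ℕ
sumF {zero} f = 0
sumF {suc K} f = f fz + sumF (λ t → f (fs t))

anyF-true : ∀ {K} (f : Fin K → Bool) t → f t ≡ true → anyF f ≡ true
anyF-true f fz e rewrite e = refl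
anyF-true f (fs t) e with f fz
... | true = refl
... | false = anyF-true (λ t → f (fs t)) t e

anyF-false : ∀ {K} (f : Fin K → Bool) → (∀ t → f t ≡ false) → anyF f ≡ false
anyF-false {zero} f h = refl
anyF-false {suc K} f h rewrite h fz = anyF-false (λ t → f (fs t)) (λ t → h (fs t))

rank-anyF : ∀ {K} (f : Fin K → ℕ → Bool) V → rank (λ u → anyF (λ t → f t u)) V ≤ sumF (λ t → rank (f t) V)
rank-anyF {zero} f V = ≤-reflexive (rank0 V)
  where
  rank0 : ∀ V → rank (λ _ → false) V ≡ 0
  rank0 zero = refl
  rank0 (suc V) = trans (+-identityʳ _) (rank0 V)
rank-anyF {suc K} f V = ≤-trans (rank-∨ (f fz) (λ u → anyF (λ t → f (fs t) u)) V)
  (+-monoʳ-≤ (rank (f fz) V) (rank-anyF (λ t → f (fs t)) V))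

sumF-mono : ∀ {K} (f g : Fin K → ℕ) → (∀ t → f t ≤ g t) → sumF f ≤ sumF g
sumF-mono {zero} f g h = z≤n
sumF-mono {suc K} f g h = +-mono-≤ (h fz) (sumF-mono (λ t → f (fs t)) (λ t → g (fs t)) (λ t → h (fs t)))

sumF-+ : ∀ {K} (f : Fin K → ℕ) c → sumF (λ t → f t + c) ≡ sumF f + K * c
sumF-+ {zero} f c = refl
sumF-+ {suc K} f c = trans (cong (f fz + c +_) (sumF-+ (λ t → f (fs t)) c))
  (trans (+-assoc (f fz) c (sumF (λ t → f (fs t)) + K * c))
  (trans (cong (f fz +_) (trans (sym (+-assoc c _ _)) (trans (cong (_+ K * c) (+-comm c _)) (+-assoc _ c (K * c)))))
  (sym (+-assoc (f fz) _ _))))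

rank-addpt : ∀ s t w V → t w ≡ true → s w ≡ false → (∀ u → u ≢ w → t u ≡ s u) → w < V →
  rank t V ≡ suc (rank s V)
rank-addpt s t w zero tw sw h ()
rank-addpt s t w (suc V) tw sw h lt with V ≟ w
... | yes refl = trans (rank-true t V tw)
     (cong suc (trans (rank-ext t s V (λ u u<V → h u (λ e → <-irrefl e u<V))) (sym (rank-false s V sw))))
... | no V≢w = trans (cong₂ _+_ (rank-addpt s t w V tw sw h (≤∧≢⇒< (s≤s⁻¹ lt) (λ e → V≢w (sym e)))) (cong bit (h V V≢w)))
                 refl

anyF-cong : ∀ {K} (f g : Fin K → Bool) → (∀ t → f t ≡ g t) → anyF f ≡ anyF g
anyF-cong {zero} f g h = refl
anyF-cong {suc K} f g h = cong₂ _∨_ (h fz) (anyF-cong (λ t → f (fs t)) (λ t → g (fs t)) (λ t → h (fs t)))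

-- Enumerating k-tuples of bounded sum

cons : ∀ {k} → ℕ → (Fin k → ℕ) → Fin (suc k) → ℕ
cons h f fz = h
cons h f (fs t) = f t

Fin1-irrelevant : ∀ {m} → m ≡ 1 → (i j : Fin m) → i ≡ j
Fin1-irrelevant refl fz fz = refl

subst-Fin-injective : ∀ {m n} (e : m ≡ n) {i j : Fin m} → subst Fin e i ≡ subst Fin e j → i ≡ j
subst-Fin-injective refl eq = eq

splitAt-injective : ∀ m {n} (i j : Fin (m + n)) → splitAt m i ≡ splitAt m j → i ≡ j
splitAt-injective m {n} i j e = trans (sym (join-splitAt m n i)) (trans (cong (join m n) e) (join-splitAt m n j))

pascal : ∀ k T → (suc T + suc k) C suc k ≡ (suc T + k) C k + (T + suc k) C suc k
pascal k T = trans (sym (nCk+nC[k+1]≡[n+1]C[k+1] (T + suc k) k)) (cong (λ m → m C k + (T + suc k) C suc k) (+-suc T k))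

pascal-split : ∀ k T → Fin ((suc T + suc k) C suc k) → Fin ((suc T + k) C k) ⊎ Fin ((T + suc k) C suc k)
pascal-split k T i = splitAt ((suc T + k) C k) (subst Fin (pascal k T) i)

pascal-split-injective : ∀ k T i j → pascal-split k T i ≡ pascal-split k T j → i ≡ j
pascal-split-injective k T i j e = subst-Fin-injective (pascal k T) (splitAt-injective ((suc T + k) C k) _ _ e)

-- Pascal's rule splits the k-tuples with sum ≤ T + 1 into those starting with 0
-- and those obtained from a tuple with sum ≤ T by incrementing its first entry.
mutual
  composition : ∀ k T → Fin ((T + k) C k) → Fin k → ℕ
  composition zero T i ()
  composition (suc k) zero i t = 0
  composition (suc k) (suc T) i = composition-split k T (pascal-split k T i)

  composition-split : ∀ k T → Fin ((suc T + k) C k) ⊎ Fin ((T + suc k) C suc k) → Fin (suc k) → ℕ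
  composition-split k T (inj₁ x) = cons 0 (composition k (suc T) x)
  composition-split k T (inj₂ y) = cons (suc (composition (suc k) T y fz)) (λ t → composition (suc k) T y (fs t))

sumF-zero : ∀ k → sumF {k} (λ _ → 0) ≡ 0
sumF-zero zero = refl
sumF-zero (suc k) = sumF-zero k

mutual
  composition-sum≤ : ∀ k T i → sumF (composition k T i) ≤ T
  composition-sum≤ zero T i = z≤n
  composition-sum≤ (suc k) zero i = ≤-reflexive (sumF-zero (suc k))
  composition-sum≤ (suc k) (suc T) i = composition-split-sum≤ k T (pascal-split k T i)

  composition-split-sum≤ : ∀ k T s → sumF (composition-split k T s) ≤ suc T
  composition-split-sum≤ k T (inj₁ x) = composition-sum≤ k (suc T) x
  composition-split-sum≤ k T (inj₂ y) = s≤s (composition-sum≤ (suc k) T y)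

mutual
  composition-injective : ∀ k T i j → (∀ t → composition k T i t ≡ composition k T j t) → i ≡ j
  composition-injective zero T i j h = Fin1-irrelevant refl i j
  composition-injective (suc k) zero i j h = Fin1-irrelevant (nCn≡1 (suc k)) i j
  composition-injective (suc k) (suc T) i j h =
    pascal-split-injective k T i j (composition-split-injective k T (pascal-split k T i) (pascal-split k T j) h)

  composition-split-injective : ∀ k T s s' → (∀ t → composition-split k T s t ≡ composition-split k T s' t) → s ≡ s'
  composition-split-injective k T (inj₁ x) (inj₁ x') h = cong inj₁ (composition-injective k (suc T) x x' (λ t → h (fs t)))
  composition-split-injective k T (inj₁ x) (inj₂ y) h with h fz
  ... | ()
  composition-split-injective k T (inj₂ y) (inj₁ x) h with h fz
  ... | ()
  composition-split-injective k T (inj₂ y) (inj₂ y') h =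
    cong inj₂ (composition-injective (suc k) T y y' λ { fz → suc-injective (h fz) ; (fs t) → h (fs t) })

module Selection {N : ℕ} (G : OGraph N) (s : ℕ → Bool) (n : ℕ) (count : rank s N ≡ n) where
  select-spec : (p : Fin n) → Σ ℕ λ v → v < N × s v ≡ true × rank s v ≡ toℕ p
  select-spec p = rank-exists s N (toℕ p) (subst (toℕ p <_) (sym count) (toℕ<n p))

  select : Fin n → ℕ
  select p = proj₁ (select-spec p)

  select<N : ∀ p → select p < N
  select<N p = proj₁ (proj₂ (select-spec p))

  select-selected : ∀ p → s (select p) ≡ true
  select-selected p = proj₁ (proj₂ (proj₂ (select-spec p)))

  select-rank : ∀ p → rank s (select p) ≡ toℕ p
  select-rank p = proj₂ (proj₂ (proj₂ (select-spec p)))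

  embed : Fin n → Fin N
  embed p = fromℕ< (select<N p)

  select-increasing : ∀ i j → toℕ i < toℕ j → select i < select j
  select-increasing i j lt with select j ≤? select i
  ... | no gt = ≰⇒> gt
  ... | yes le = ⊥-elim (<⇒≱ lt (subst₂ _≤_ (select-rank j) (select-rank i) (rank-mono s le)))

  embed-increasing : StrictlyIncreasing embed
  embed-increasing i j lt = subst₂ _<_ (sym (toℕ-fromℕ< (select<N i))) (sym (toℕ-fromℕ< (select<N j))) (select-increasing i j lt)

  graph : OGraph n
  graph = induced G embed embed-increasing

  graph-adj : ∀ p q → adj graph p q ≡ adjℕ G (select p) (select q)
  graph-adj p q = sym (adjℕ-fromℕ< G (select p) (select q) (select<N p) (select<N q))

  select-unique : ∀ v p → s v ≡ true → rank s v ≡ toℕ p → select p ≡ v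
  select-unique v p sv rv = rank-inj s (select-selected p) sv (trans (select-rank p) (sym rv))

  rank<n : ∀ v → s v ≡ true → v < N → rank s v < n
  rank<n v sv v<N = subst (rank s v <_) count (rank-strict s sv v<N)

  position : ∀ v → s v ≡ true → v < N → Fin n
  position v sv v<N = fromℕ< (rank<n v sv v<N)

  toℕ-position : ∀ v sv v<N → toℕ (position v sv v<N) ≡ rank s v
  toℕ-position v sv v<N = toℕ-fromℕ< (rank<n v sv v<N)

  select-position : ∀ v sv v<N → select (position v sv v<N) ≡ v
  select-position v sv v<N = select-unique v _ sv (sym (toℕ-position v sv v<N))

-- The positions of x and the next selected vertex hold x, r for s and the twins
-- x, x1 for s'; the vertex z tells x from r but not x from x1.
twin-separated : ∀ {N} (G : OGraph N) (s s' : ℕ → Bool) n (c : rank s N ≡ n) (c' : rank s' N ≡ n) →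
  ∀ x r z x1 → x < N → r < N → z < N → x1 < N →
  s x ≡ true → s' x ≡ true → rank s x ≡ rank s' x →
  s r ≡ true → rank s r ≡ suc (rank s x) →
  s' x1 ≡ true → rank s' x1 ≡ suc (rank s' x) →
  s z ≡ true → z ≢ x → z ≢ r →
  (∀ w → w ≢ x → w ≢ x1 → adjℕ G x w ≡ adjℕ G x1 w) →
  adjℕ G x z ≢ adjℕ G r z →
  ¬ (Selection.graph G s n c ≈G Selection.graph G s' n c')
twin-separated G s s' n c c' x r z x1 x< r< z< x1< sx s'x rx sr rr s'x1 rx1 sz zx zr hom ne eqG =
  ne (begin
    adjℕ G x z                 ≡⟨ cong₂ (adjℕ G) (sym selpx) (sym selqz) ⟩
    adjℕ G (Sel.select p) (Sel.select q)   ≡⟨ sym (Sel.graph-adj p q) ⟩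
    adj Sel.graph p q                ≡⟨ eqG p q ⟩
    adj Sel'.graph p q               ≡⟨ Sel'.graph-adj p q ⟩
    adjℕ G (Sel'.select p) (Sel'.select q) ≡⟨ cong (λ v → adjℕ G v (Sel'.select q)) sel'px ⟩
    adjℕ G x (Sel'.select q)        ≡⟨ hom (Sel'.select q) wx wx1 ⟩
    adjℕ G x1 (Sel'.select q)       ≡⟨ cong (λ v → adjℕ G v (Sel'.select q)) (sym sel'p1) ⟩
    adjℕ G (Sel'.select p1) (Sel'.select q) ≡⟨ sym (Sel'.graph-adj p1 q) ⟩
    adj Sel'.graph p1 q              ≡⟨ sym (eqG p1 q) ⟩
    adj Sel.graph p1 q               ≡⟨ Sel.graph-adj p1 q ⟩
    adjℕ G (Sel.select p1) (Sel.select q) ≡⟨ cong₂ (adjℕ G) selp1 selqz ⟩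
    adjℕ G r z ∎)
  where
  open ≡-Reasoning
  module Sel = Selection G s n c
  module Sel' = Selection G s' n c'
  p : Fin n
  p = Sel.position x sx x<
  p1 : Fin n
  p1 = Sel.position r sr r<
  q : Fin n
  q = Sel.position z sz z<
  tp : toℕ p ≡ rank s x
  tp = Sel.toℕ-position x sx x<
  tp1 : toℕ p1 ≡ rank s r
  tp1 = Sel.toℕ-position r sr r<
  tq : toℕ q ≡ rank s z
  tq = Sel.toℕ-position z sz z<
  selpx : Sel.select p ≡ x
  selpx = Sel.select-position x sx x<
  selp1 : Sel.select p1 ≡ r
  selp1 = Sel.select-position r sr r<
  selqz : Sel.select q ≡ z
  selqz = Sel.select-position z sz z<
  sel'px : Sel'.select p ≡ x
  sel'px = Sel'.select-unique x p s'x (trans (sym rx) (sym tp))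
  sel'p1 : Sel'.select p1 ≡ x1
  sel'p1 = Sel'.select-unique x1 p1 s'x1 (trans rx1 (trans (cong suc (sym rx)) (trans (sym rr) (sym tp1))))
  wx : Sel'.select q ≢ x
  wx e = zx (rank-inj s sz sx (trans (sym tq) (trans (sym (Sel'.select-rank q)) (trans (cong (rank s') e) (sym rx)))))
  wx1 : Sel'.select q ≢ x1
  wx1 e = zr (rank-inj s sz sr (trans (sym tq) (trans (sym (Sel'.select-rank q)) (trans (cong (rank s') e)
            (trans rx1 (trans (cong suc (sym rx)) (sym rr)))))))

separates? : ∀ {N} (G : OGraph N) a l (x y z : Fin N) → Dec (InInterval a (suc l) x × InInterval a (suc l) y × z ≢ x × z ≢ y × adj G x z ≢ adj G y z)
separates? G a l x y z = ((a ≤? toℕ x) ×-dec (toℕ x <? a + suc l)) ×-dec (((a ≤? toℕ y) ×-dec (toℕ y <? a + suc l)) ×-dec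
             (¬? (z ≟F x) ×-dec (¬? (z ≟F y) ×-dec ¬? (adj G x z ≟B adj G y z))))

block-extension-violation : ∀ {N} (G : OGraph N) a l → HomBlock G a l → a + l < N →
  Σ ℕ λ x → Σ ℕ λ y → Σ ℕ λ z → Within a (suc l) x × Within a (suc l) y × z ≢ x × z ≢ y × z < N ×
    adjℕ G x z ≢ adjℕ G y z
block-extension-violation {N} G a l (_ , _ , mx) a+l<N with any? (λ x → any? (λ y → any? (λ z → separates? G a l x y z)))
... | yes (x , y , z , ix , iy , zx , zy , ne) =
  toℕ x , toℕ y , toℕ z , ix , iy , (λ e → zx (toℕ-injective e)) , (λ e → zy (toℕ-injective e)) , toℕ<n z ,
  λ e → ne (trans (sym (adjℕ-toℕ G x z)) (trans e (adjℕ-toℕ G y z)))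
... | no noQ = ⊥-elim (<-irrefl (sym (proj₂ (mx a (suc l) hom ≤-refl (+-monoʳ-≤ a (n≤1+n l))))) (n<1+n l))
  where
  hom : HomInterval G a (suc l)
  hom = ≤-trans (≤-reflexive (+-suc a l)) a+l<N , λ x y ix iy z zx zy →
    decidable-stable (adj G x z ≟B adj G y z)
      (λ ne → noQ (x , y , z , ix , iy , zx , zy , ne))

-- The construction for general k

argmax : ∀ {K} (w : Fin (suc K) → ℕ) → Σ (Fin (suc K)) λ d → ∀ j → w j ≤ w d
argmax {zero} w = fz , λ { fz → ≤-refl }
argmax {suc K} w with argmax (λ t → w (fs t))
... | (d' , h) with w fz ≤? w (fs d')
...   | yes le = fs d' , λ { fz → le ; (fs t) → h t }
...   | no gt = fz , λ { fz → ≤-refl ; (fs t) → ≤-trans (h t) (<⇒≤ (≰⇒> gt)) }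

-- Block i is [a i, a i + l i); d is the rightmost block D, σ t is the block B_t
-- and r t the vertex just after it.
module Blocks {N : ℕ} (G : OGraph N) (k n : ℕ) (b : Fin (suc k) → ℕ × ℕ)
  (binj : ∀ i j → b i ≡ b j → i ≡ j)
  (bprop : ∀ i → HomBlock G (proj₁ (b i)) (proj₂ (b i)) × n + 3 ≤ proj₂ (b i)) where

  a : Fin (suc k) → ℕ
  a i = proj₁ (b i)
  l : Fin (suc k) → ℕ
  l i = proj₂ (b i)
  block : ∀ i → HomBlock G (a i) (l i)
  block i = proj₁ (bprop i)
  homogeneous : ∀ i → HomInterval G (a i) (l i)
  homogeneous i = proj₁ (proj₂ (block i))
  n+3≤l : ∀ i → n + 3 ≤ l i
  n+3≤l i = proj₂ (bprop i)
  end≤N : ∀ i → a i + l i ≤ N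
  end≤N i = proj₁ (homogeneous i)
  2≤l : ∀ i → 2 ≤ l i
  2≤l i = ≤-trans (s≤s (s≤s z≤n)) (≤-trans (m≤n+m 3 n) (n+3≤l i))

  block-unique : ∀ i j v → Within (a i) (l i) v → Within (a j) (l j) v → i ≡ j
  block-unique i j v vi vj with i ≟F j
  ... | yes e = e
  ... | no ne = ⊥-elim (blocks-disjoint G (a i) (l i) (a j) (l j) (block i) (block j)
                  (λ { (e1 , e2) → ne (binj i j (×-≡,≡→≡ (e1 , e2))) }) v vi vj)

  start∈ : ∀ i → Within (a i) (l i) (a i)
  start∈ i = block-start G (a i) (l i) (block i)

  second∈ : ∀ i → Within (a i) (l i) (suc (a i))
  second∈ i = n≤1+n _ , ≤-trans (≤-reflexive (+-comm 2 (a i))) (+-monoʳ-≤ (a i) (2≤l i))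

  start-injective : ∀ i j → a i ≡ a j → i ≡ j
  start-injective i j e = block-unique i j (a i) (start∈ i) (subst (λ v → Within (a j) (l j) v) (sym e) (start∈ j))

  dM : Σ (Fin (suc k)) λ d → ∀ j → a j ≤ a d
  dM = argmax a
  d : Fin (suc k)
  d = proj₁ dM
  d-rightmost : ∀ j → a j ≤ a d
  d-rightmost = proj₂ dM

  σ : Fin k → Fin (suc k)
  σ = punchIn d
  σ≢d : ∀ t → σ t ≢ d
  σ≢d t = punchInᵢ≢i d t

  aσ<ad : ∀ t → a (σ t) < a d
  aσ<ad t = ≤∧≢⇒< (d-rightmost (σ t)) (λ e → σ≢d t (start-injective (σ t) d e))

  r : Fin k → ℕ
  r t = a (σ t) + l (σ t)

  r≤ad : ∀ t → r t ≤ a d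
  r≤ad t = block-ends-before G (a (σ t)) (l (σ t)) (a d) (l d) (block (σ t)) (block d) (aσ<ad t)

  ad<N : a d < N
  ad<N = <-≤-trans (proj₂ (start∈ d)) (end≤N d)

  r<N : ∀ t → r t < N
  r<N t = ≤-<-trans (r≤ad t) ad<N

  end-in-block⇒start : ∀ t j → Within (a j) (l j) (r t) → r t ≡ a j
  end-in-block⇒start t j (aj≤r , r<ej) with a j ≟ r t
  ... | yes e = sym e
  ... | no ne = ⊥-elim (<-irrefl refl (proj₂ notin))
    where
    i : Fin (suc k)
    i = σ t
    aj<r : a j < r t
    aj<r = ≤∧≢⇒< aj≤r ne
    v : ℕ
    v = r t ∸ 1
    v+1 : suc v ≡ r t
    v+1 = trans (+-comm 1 v) (m∸n+n≡m (≤-trans (s≤s z≤n) aj<r))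
    vj : Within (a j) (l j) v
    vj = s≤s⁻¹ (subst (suc (a j) ≤_) (sym v+1) aj<r) , <-trans (subst (v <_) v+1 (n<1+n v)) r<ej
    vi : Within (a i) (l i) v
    vi = s≤s⁻¹ (subst (suc (a i) ≤_) (sym v+1) (≤-trans (≤-reflexive (+-comm 1 (a i))) (+-monoʳ-≤ (a i) (proj₁ (block i))))) ,
         subst (v <_) v+1 (n<1+n v)
    ij : i ≡ j
    ij = block-unique i j v vi vj
    notin : Within (a i) (l i) (r t)
    notin = subst (λ q → Within (a q) (l q) (r t)) (sym ij) (aj≤r , r<ej)

  ¬2+n≤n : ∀ {u v} → u ≡ v → ¬ (2 + u ≤ v)
  ¬2+n≤n refl h = 1+n≰n (≤-trans (n≤1+n _) h)

  ¬2+n≤1+n : ∀ {u v} → u ≡ v → ¬ (2 + u ≤ suc v)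
  ¬2+n≤1+n refl h = 1+n≰n (s≤s⁻¹ h)

  -- A separator avoids every block beyond its first two vertices, which every
  -- selection contains, so lengthening a selected initial segment of a block
  -- never passes over it.
  record Separator (t : Fin k) : Set where
    field
      z : ℕ
      z<N : z < N
      zr : z ≢ r t
      separates : ∀ x → suc (a (σ t)) ≤ x → x < r t → adjℕ G x z ≢ adjℕ G (r t) z
      ∉own : ¬ (suc (a (σ t)) ≤ z × z < r t)
      ∉interiors : ∀ j → ¬ (2 + a j ≤ z × z < a j + l j)

  ∈own : ∀ t x → suc (a (σ t)) ≤ x → x < r t → Within (a (σ t)) (l (σ t)) x
  ∈own t x h1 h2 = <⇒≤ h1 , h2

  -- A separating vertex z inside a block is replaced by a twin of it among the
  -- first two vertices of that block.
  module _ (t : Fin k) (x z : ℕ) (ix : Within (a (σ t)) (l (σ t)) x) (zx : z ≢ x) (zr : z ≢ r t) (z<N : z < N)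
           (ne : adjℕ G x z ≢ adjℕ G (r t) z) where
    private
      i : Fin (suc k)
      i = σ t

    separator-outsideBlocks : (∀ j → ¬ Within (a j) (l j) z) → Separator t
    separator-outsideBlocks nz = record { z = z ; z<N = z<N ; zr = zr ; separates = separates′ ; ∉own = λ iz → nz i (<⇒≤ (proj₁ iz) , proj₂ iz)
                      ; ∉interiors = λ j iz → nz j (≤-trans (m≤n+m (a j) 2) (proj₁ iz) , proj₂ iz) }
      where
      separates′ : ∀ x' → suc (a i) ≤ x' → x' < r t → adjℕ G x' z ≢ adjℕ G (r t) z
      separates′ x' h1 h2 e = ne (trans (hom-adjℕ G _ _ (homogeneous i) x x' z ix (∈own t x' h1 h2) zx
                          (λ e' → nz i (subst (Within (a i) (l i)) (sym e') (∈own t x' h1 h2)))) e)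

    separator-inOwnBlock : Within (a i) (l i) z → Separator t
    separator-inOwnBlock iz = record { z = a i ; z<N = <-≤-trans (proj₂ (start∈ i)) (end≤N i) ; zr = azr ; separates = separates′ ; ∉own = λ h → <-irrefl refl (proj₁ h)
                      ; ∉interiors = λ j h → ¬2+n≤n (cong a (block-unique j i (a i) (≤-trans (m≤n+m (a j) 2) (proj₁ h) , proj₂ h) (start∈ i))) (proj₁ h) }
      where
      azr : a i ≢ r t
      azr e = <-irrefl e (proj₂ (start∈ i))
      separates′ : ∀ x' → suc (a i) ≤ x' → x' < r t → adjℕ G x' (a i) ≢ adjℕ G (r t) (a i)
      separates′ x' h1 h2 e = ne (trans pe (trans e re))
        where
        pe : adjℕ G x z ≡ adjℕ G x' (a i)
        pe = hom-pairs G (a i) (l i) (homogeneous i) x z x' (a i) ix iz (∈own t x' h1 h2) (start∈ i) (λ e → zx (sym e)) (λ e → <-irrefl (sym e) h1)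
        re : adjℕ G (r t) (a i) ≡ adjℕ G (r t) z
        re = trans (adjℕ-sym G _ _) (trans (hom-adjℕ G _ _ (homogeneous i) (a i) z (r t) (start∈ i) iz (λ e → azr (sym e)) (λ e → zr (sym e))) (adjℕ-sym G _ _))

    separator-inOtherBlock : ∀ j → j ≢ i → Within (a j) (l j) z → Separator t
    separator-inOtherBlock j jne iz = record { z = suc (a j) ; z<N = <-≤-trans (proj₂ sj) (end≤N j) ; zr = szr ; separates = separates′
                           ; ∉own = λ h → notj (suc (a j)) (∈own t (suc (a j)) (proj₁ h) (proj₂ h)) sj
                           ; ∉interiors = λ j' h → ¬2+n≤1+n (cong a (block-unique j' j (suc (a j)) (≤-trans (m≤n+m (a j') 2) (proj₁ h) , proj₂ h) sj)) (proj₁ h) }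
      where
      sj : Within (a j) (l j) (suc (a j))
      sj = second∈ j
      notj : ∀ v → Within (a i) (l i) v → Within (a j) (l j) v → ⊥
      notj v vi vj = jne (block-unique j i v vj vi)
      szr : suc (a j) ≢ r t
      szr e = 1+n≢n (trans e (end-in-block⇒start t j (subst (Within (a j) (l j)) e sj)))
      separates′ : ∀ x' → suc (a i) ≤ x' → x' < r t → adjℕ G x' (suc (a j)) ≢ adjℕ G (r t) (suc (a j))
      separates′ x' h1 h2 e = ne (trans e2 (trans (sym e1) (trans e e3)))
        where
        ix' : Within (a i) (l i) x'
        ix' = ∈own t x' h1 h2
        e1 : adjℕ G x' (suc (a j)) ≡ adjℕ G x' z
        e1 = trans (adjℕ-sym G _ _) (trans (hom-adjℕ G _ _ (homogeneous j) (suc (a j)) z x' sj iz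
               (λ e → notj x' ix' (subst (Within (a j) (l j)) (sym e) sj)) (λ e → notj x' ix' (subst (Within (a j) (l j)) (sym e) iz)))
               (adjℕ-sym G _ _))
        e2 : adjℕ G x z ≡ adjℕ G x' z
        e2 = hom-adjℕ G _ _ (homogeneous i) x x' z ix ix' zx (λ e → notj z (subst (Within (a i) (l i)) (sym e) ix') iz)
        e3 : adjℕ G (r t) (suc (a j)) ≡ adjℕ G (r t) z
        e3 = trans (adjℕ-sym G _ _) (trans (hom-adjℕ G _ _ (homogeneous j) (suc (a j)) z (r t) sj iz (λ e → szr (sym e)) (λ e → zr (sym e))) (adjℕ-sym G _ _))

    separator-from : Separator t
    separator-from with any? (λ j → within? (a j) (l j) z)
    ... | no nz = separator-outsideBlocks (λ j iz → nz (j , iz))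
    ... | yes (j , iz) with j ≟F i
    ...   | yes refl = separator-inOwnBlock iz
    ...   | no jne = separator-inOtherBlock j jne iz

  separator : ∀ t → Separator t
  separator t with block-extension-violation G (a (σ t)) (l (σ t)) (block (σ t)) (r<N t)
  ... | (x0 , y0 , z0 , ix0 , iy0 , zx0 , zy0 , z<N , ne0) with x0 <? r t | y0 <? r t
  ...   | yes x< | yes y< = ⊥-elim (ne0 (hom-adjℕ G _ _ (homogeneous (σ t)) x0 y0 z0 (proj₁ ix0 , x<) (proj₁ iy0 , y<) zx0 zy0))
  ...   | yes x< | no y≮ = separator-from t x0 z0 (proj₁ ix0 , x<) zx0 (subst (z0 ≢_) yr zy0) z<N
                              (subst (λ v → adjℕ G x0 z0 ≢ adjℕ G v z0) yr ne0)
    where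
    yr : y0 ≡ r t
    yr = ≤-antisym (s≤s⁻¹ (subst (y0 <_) (+-suc _ _) (proj₂ iy0))) (≮⇒≥ y≮)
  ...   | no x≮ | yes y< = separator-from t y0 z0 (proj₁ iy0 , y<) zy0 (subst (z0 ≢_) xr zx0) z<N
                              (λ e → ne0 (sym (subst (λ v → adjℕ G y0 z0 ≡ adjℕ G v z0) (sym xr) e)))
    where
    xr : x0 ≡ r t
    xr = ≤-antisym (s≤s⁻¹ (subst (x0 <_) (+-suc _ _) (proj₂ ix0))) (≮⇒≥ x≮)
  ...   | no x≮ | no y≮ = ⊥-elim (ne0 (cong (λ v → adjℕ G v z0) (trans xr (sym yr))))
    where
    xr : x0 ≡ r t
    xr = ≤-antisym (s≤s⁻¹ (subst (x0 <_) (+-suc _ _) (proj₂ ix0))) (≮⇒≥ x≮)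
    yr : y0 ≡ r t
    yr = ≤-antisym (s≤s⁻¹ (subst (y0 <_) (+-suc _ _) (proj₂ iy0))) (≮⇒≥ y≮)

  sep : Fin k → ℕ
  sep t = Separator.z (separator t)

  gadget : (Fin k → ℕ) → Fin k → ℕ → Bool
  gadget c t u = withinᵇ (a (σ t)) (c t + 2) u ∨ (isᵇ (r t) u ∨ isᵇ (sep t) u)

  chosen : (Fin k → ℕ) → ℕ → ℕ → Bool
  chosen c md u = withinᵇ (a d) md u ∨ anyF (λ t → gadget c t u)

  gadget→chosen : ∀ c md t u → gadget c t u ≡ true → chosen c md u ≡ true
  gadget→chosen c md t u g = ∨-trueʳ (withinᵇ (a d) md u) _ (anyF-true (λ t → gadget c t u) t g)

  segment-chosen : ∀ c md t u → Within (a (σ t)) (c t + 2) u → chosen c md u ≡ true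
  segment-chosen c md t u h = gadget→chosen c md t u (∨-trueˡ _ _ (withinᵇ-true (a (σ t)) (c t + 2) u h))

  end-chosen : ∀ c md t → chosen c md (r t) ≡ true
  end-chosen c md t = gadget→chosen c md t (r t) (∨-trueʳ (withinᵇ (a (σ t)) (c t + 2) (r t)) _ (∨-trueˡ _ _ (isᵇ-refl (r t))))

  sep-chosen : ∀ c md t → chosen c md (sep t) ≡ true
  sep-chosen c md t = gadget→chosen c md t (sep t)
    (∨-trueʳ (withinᵇ (a (σ t)) (c t + 2) (sep t)) _ (∨-trueʳ (isᵇ (r t) (sep t)) _ (isᵇ-refl (sep t))))

  rank-gadget : ∀ c t → rank (gadget c t) N ≤ c t + 4
  rank-gadget c t = ≤-trans (rank-∨ _ _ N)
    (≤-trans (+-mono-≤ (rank-interval _ (a (σ t)) (c t + 2) N (withinᵇ-sound _ _))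
               (≤-trans (rank-∨ _ _ N) (+-mono-≤ (rank-interval _ (r t) 1 N (isᵇ-within (r t))) (rank-interval _ (sep t) 1 N (isᵇ-within (sep t))))))
      (≤-reflexive (+-assoc (c t) 2 2)))

  rank-chosen : ∀ c → rank (chosen c 2) N ≤ 2 + (sumF c + k * 4)
  rank-chosen c = ≤-trans (rank-∨ _ _ N) (+-mono-≤ (rank-interval _ (a d) 2 N (withinᵇ-sound _ _))
    (≤-trans (rank-anyF (gadget c) N) (≤-trans (sumF-mono _ _ (rank-gadget c)) (≤-reflexive (sumF-+ c 4)))))

  module _ (c : Fin k → ℕ) (cb : ∀ t → c t + 2 ≤ l (σ t)) where
    chunk≤r : ∀ t → a (σ t) + (c t + 2) ≤ r t
    chunk≤r t = +-monoʳ-≤ (a (σ t)) (cb t)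

    rank-chosen-suc : ∀ md → 2 ≤ md → md < l d → rank (chosen c (suc md)) N ≡ suc (rank (chosen c md) N)
    rank-chosen-suc md 2≤md md<l = rank-addpt (chosen c md) (chosen c (suc md)) w N tw sw pw w<N
      where
      w : ℕ
      w = a d + md
      w<N : w < N
      w<N = <-≤-trans (+-monoʳ-< (a d) md<l) (end≤N d)
      ad<w : a d < w
      ad<w = ≤-trans (≤-reflexive (+-comm 1 (a d))) (+-monoʳ-≤ (a d) (≤-trans (s≤s z≤n) 2≤md))
      tw : chosen c (suc md) w ≡ true
      tw = ∨-trueˡ _ _ (withinᵇ-true (a d) (suc md) w (m≤m+n (a d) md , +-monoʳ-< (a d) (n<1+n md)))
      gadget-false : ∀ t → gadget c t w ≡ false
      gadget-false t = ∨-false (withinᵇ (a (σ t)) (c t + 2) w) (isᵇ (r t) w ∨ isᵇ (sep t) w)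
        (withinᵇ-false (a (σ t)) (c t + 2) w (λ h → <⇒≱ (<-≤-trans (proj₂ h) (chunk≤r t)) (≤-trans (r≤ad t) (<⇒≤ ad<w))))
        (∨-false (isᵇ (r t) w) (isᵇ (sep t) w) (isᵇ-false (r t) w (λ e → <-irrefl (sym e) (≤-<-trans (r≤ad t) ad<w)))
          (isᵇ-false (sep t) w (λ e → Separator.∉interiors (separator t) d (subst (λ v → 2 + a d ≤ v × v < a d + l d) e
             (≤-trans (≤-reflexive (+-comm 2 (a d))) (+-monoʳ-≤ (a d) 2≤md) , +-monoʳ-< (a d) md<l)))))
      sw : chosen c md w ≡ false
      sw = ∨-false (withinᵇ (a d) md w) _ (withinᵇ-false (a d) md w (λ h → <-irrefl refl (proj₂ h))) (anyF-false (λ t → gadget c t w) gadget-false)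
      pw : ∀ u → u ≢ w → chosen c (suc md) u ≡ chosen c md u
      pw u ne = cong (_∨ anyF (λ t → gadget c t u)) (withinᵇ-suc (a d) md u ne)

    rank-chosen-+ : ∀ e → 2 + e ≤ l d → rank (chosen c (2 + e)) N ≡ rank (chosen c 2) N + e
    rank-chosen-+ zero _ = sym (+-identityʳ _)
    rank-chosen-+ (suc e) le = trans (rank-chosen-suc (2 + e) (m≤m+n 2 e) le)
      (trans (cong suc (rank-chosen-+ e (≤-trans (n≤1+n _) le))) (sym (+-suc _ e)))

    lastLength : ℕ
    lastLength = 2 + (n ∸ rank (chosen c 2) N)

    rank-chosen-last : rank (chosen c 2) N ≤ n → rank (chosen c lastLength) N ≡ n
    rank-chosen-last h = trans (rank-chosen-+ _ le) (m+[n∸m]≡n h)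
      where
      le : 2 + (n ∸ rank (chosen c 2) N) ≤ l d
      le = ≤-trans (+-monoʳ-≤ 2 (m∸n≤m n (rank (chosen c 2) N))) (≤-trans (≤-trans (≤-reflexive (+-comm 2 n)) (+-monoʳ-≤ n (n≤1+n 2))) (n+3≤l d))

  familyGraph : (c : Fin k → ℕ) (cb : ∀ t → c t + 2 ≤ l (σ t)) → rank (chosen c 2) N ≤ n → OGraph n
  familyGraph c cb h = Selection.graph G (chosen c (lastLength c cb)) n (rank-chosen-last c cb h)

  module Separation (c c' : Fin k → ℕ) (cb : ∀ t → c t + 2 ≤ l (σ t)) (cb' : ∀ t → c' t + 2 ≤ l (σ t))
           (h : rank (chosen c 2) N ≤ n) (h' : rank (chosen c' 2) N ≤ n)
           (t0 : Fin k) (lt : c t0 < c' t0) (mn : ∀ t → c t ≢ c' t → a (σ t0) ≤ a (σ t)) where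
    i : Fin (suc k)
    i = σ t0
    s : ℕ → Bool
    s = chosen c (lastLength c cb)
    s' : ℕ → Bool
    s' = chosen c' (lastLength c' cb')
    x : ℕ
    x = a i + (c t0 + 1)
    chunkR : a i + (c t0 + 2) ≤ r t0
    chunkR = chunk≤r c cb t0
    chunkR' : a i + (c' t0 + 2) ≤ r t0
    chunkR' = chunk≤r c' cb' t0
    x1eq : suc x ≡ a i + (c t0 + 2)
    x1eq = trans (sym (+-suc (a i) (c t0 + 1))) (cong (a i +_) (sym (+-suc (c t0) 1)))
    x<chunk : x < a i + (c t0 + 2)
    x<chunk = ≤-reflexive x1eq
    x1<chunk' : suc x < a i + (c' t0 + 2)
    x1<chunk' = subst (_< a i + (c' t0 + 2)) (sym x1eq) (+-monoʳ-< (a i) (+-monoˡ-< 2 lt))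
    x<chunk' : x < a i + (c' t0 + 2)
    x<chunk' = <-trans (n<1+n x) x1<chunk'
    x<r : x < r t0
    x<r = <-≤-trans x<chunk chunkR
    x1<r : suc x < r t0
    x1<r = <-≤-trans x1<chunk' chunkR'
    ai<x : suc (a i) ≤ x
    ai<x = ≤-trans (≤-reflexive (+-comm 1 (a i))) (+-monoʳ-≤ (a i) (m≤n+m 1 (c t0)))
    ai≤x : a i ≤ x
    ai≤x = m≤m+n (a i) _
    xB : Within (a i) (l i) x
    xB = ai≤x , x<r
    x1B : Within (a i) (l i) (suc x)
    x1B = ≤-trans ai≤x (n≤1+n x) , x1<r

    segment-agree : ∀ u → u < x → ∀ t → Dec (c t ≡ c' t) → Dec (t ≡ t0) →
      withinᵇ (a (σ t)) (c t + 2) u ≡ withinᵇ (a (σ t)) (c' t + 2) u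
    segment-agree u u<x t (yes e) _ = cong (λ v → withinᵇ (a (σ t)) (v + 2) u) e
    segment-agree u u<x t (no ne) (yes refl) = withinᵇ-agree (a (σ t)) (c t + 2) (c' t + 2) u (<-trans u<x x<chunk) (<-trans u<x x<chunk')
    segment-agree u u<x t (no ne) (no tne) = withinᵇ-agree (a (σ t)) (c t + 2) (c' t + 2) u
        (≤-trans u<aσ (m≤m+n (a (σ t)) (c t + 2))) (≤-trans u<aσ (m≤m+n (a (σ t)) (c' t + 2)))
      where
      ai<aσ : a i < a (σ t)
      ai<aσ = ≤∧≢⇒< (mn t ne) (λ e → tne (sym (punchIn-injective d t0 t (start-injective i (σ t) e))))
      u<aσ : u < a (σ t)
      u<aσ = <-≤-trans (<-trans u<x x<r) (block-ends-before G (a i) (l i) (a (σ t)) (l (σ t)) (block i) (block (σ t)) ai<aσ)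

    gadget-agree : ∀ u → u < x → ∀ t → gadget c t u ≡ gadget c' t u
    gadget-agree u u<x t = cong (_∨ (isᵇ (r t) u ∨ isᵇ (sep t) u)) (segment-agree u u<x t (c t ≟ c' t) (t ≟F t0))

    selections-agree : ∀ u → u < x → s u ≡ s' u
    selections-agree u u<x = cong₂ _∨_ p1 p2
      where
      u<ad : u < a d
      u<ad = <-≤-trans (<-trans u<x x<r) (r≤ad t0)
      p1 : withinᵇ (a d) (lastLength c cb) u ≡ withinᵇ (a d) (lastLength c' cb') u
      p1 = withinᵇ-agree (a d) (lastLength c cb) (lastLength c' cb') u (≤-trans u<ad (m≤m+n (a d) _)) (≤-trans u<ad (m≤m+n (a d) _))
      p2 : anyF (λ t → gadget c t u) ≡ anyF (λ t → gadget c' t u)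
      p2 = anyF-cong (λ t → gadget c t u) (λ t → gadget c' t u) (gadget-agree u u<x)

    unselected-before-end : ∀ u → suc x ≤ u → u < r t0 → s u ≡ false
    unselected-before-end u x<u u<r = ∨-false (withinᵇ (a d) (lastLength c cb) u) (anyF (λ t → gadget c t u))
        (withinᵇ-false (a d) (lastLength c cb) u (λ hh → <⇒≱ (<-≤-trans u<r (r≤ad t0)) (proj₁ hh)))
        (anyF-false (λ t → gadget c t u) gadget-false)
      where
      uB : Within (a i) (l i) u
      uB = ≤-trans ai≤x (≤-trans (n≤1+n x) x<u) , u<r
      tEq : ∀ t → Within (a (σ t)) (l (σ t)) u → t ≡ t0
      tEq t ut = punchIn-injective d t t0 (block-unique (σ t) i u ut uB)
      chunkBad : ∀ t → t ≡ t0 → u < a (σ t) + (c t + 2) → ⊥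
      chunkBad t refl hh = <⇒≱ hh (subst (_≤ u) x1eq x<u)
      2ai≤u : 2 + a i ≤ u
      2ai≤u = ≤-trans (≤-reflexive (+-comm 2 (a i))) (≤-trans (+-monoʳ-≤ (a i) (m≤n+m 2 (c t0))) (subst (_≤ u) x1eq x<u))
      gadget-false : ∀ t → gadget c t u ≡ false
      gadget-false t = ∨-false (withinᵇ (a (σ t)) (c t + 2) u) (isᵇ (r t) u ∨ isᵇ (sep t) u)
        (withinᵇ-false (a (σ t)) (c t + 2) u (λ hh → chunkBad t (tEq t (proj₁ hh , <-≤-trans (proj₂ hh) (chunk≤r c cb t))) (proj₂ hh)))
        (∨-false (isᵇ (r t) u) (isᵇ (sep t) u)
          (isᵇ-false (r t) u (λ e → <-irrefl (sym (trans e (end-in-block⇒start t i (subst (Within (a i) (l i)) e uB))))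
                                   (≤-trans (s≤s ai≤x) x<u)))
          (isᵇ-false (sep t) u (λ e → Separator.∉interiors (separator t) i (subst (λ v → 2 + a i ≤ v × v < a i + l i) e (2ai≤u , u<r)))))

    sx : s x ≡ true
    sx = segment-chosen c _ t0 x (ai≤x , x<chunk)
    s'x : s' x ≡ true
    s'x = segment-chosen c' _ t0 x (ai≤x , x<chunk')
    s'x1 : s' (suc x) ≡ true
    s'x1 = segment-chosen c' _ t0 (suc x) (≤-trans ai≤x (n≤1+n x) , x1<chunk')
    sr : s (r t0) ≡ true
    sr = end-chosen c _ t0
    sz : s (sep t0) ≡ true
    sz = sep-chosen c _ t0

    distinct : ¬ (familyGraph c cb h ≈G familyGraph c' cb' h')
    distinct = twin-separated G s s' n (rank-chosen-last c cb h) (rank-chosen-last c' cb' h') x (r t0) (sep t0) (suc x)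
      (<-trans x<r (r<N t0)) (r<N t0) (Separator.z<N (separator t0)) (<-trans x1<r (r<N t0))
      sx s'x (rank-ext s s' x selections-agree)
      sr (trans (rank-skip s (suc x) (r t0) (<⇒≤ x1<r) (λ u a b → unselected-before-end u a b)) (rank-true s x sx))
      s'x1 (rank-true s' x s'x)
      sz (λ e → Separator.∉own (separator t0) (subst (λ v → suc (a i) ≤ v × v < r t0) (sym e) (ai<x , x<r))) (Separator.zr (separator t0))
      (λ w wx wx1 → hom-adjℕ G (a i) (l i) (homogeneous i) x (suc x) w xB x1B wx wx1)
      (Separator.separates (separator t0) x ai<x x<r)

argmin-among : ∀ {K} (Q : Fin K → Set) → (∀ t → Dec (Q t)) → (w : Fin K → ℕ) → Σ (Fin K) Q →
  Σ (Fin K) λ t0 → Q t0 × (∀ t → Q t → w t0 ≤ w t)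
argmin-among {zero} Q Q? w (() , _)
argmin-among {suc K} Q Q? w (t1 , q1) with any? (λ t → Q? (fs t))
... | yes ex with argmin-among (λ t → Q (fs t)) (λ t → Q? (fs t)) (λ t → w (fs t)) ex
...   | (t0' , q0' , min') with Q? fz
...     | no nq = fs t0' , q0' , λ { fz q → ⊥-elim (nq q) ; (fs t) q → min' t q }
...     | yes q with w fz ≤? w (fs t0')
...       | yes le = fz , q , λ { fz _ → ≤-refl ; (fs t) qt → ≤-trans le (min' t qt) }
...       | no gt = fs t0' , q0' , λ { fz _ → <⇒≤ (≰⇒> gt) ; (fs t) qt → min' t qt }
argmin-among {suc K} Q Q? w (fz , q1) | no nex = fz , q1 , λ { fz _ → ≤-refl ; (fs t) qt → ⊥-elim (nex (t , qt)) }
argmin-among {suc K} Q Q? w (fs t1 , q1) | no nex = ⊥-elim (nex (t1 , q1))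

term≤sumF : ∀ {K} (f : Fin K → ℕ) t → f t ≤ sumF f
term≤sumF f fz = m≤m+n (f fz) _
term≤sumF f (fs t) = ≤-trans (term≤sumF (λ t → f (fs t)) t) (m≤n+m _ (f fz))

≈G-sym : ∀ {n} {G H : OGraph n} → G ≈G H → H ≈G G
≈G-sym e x y = sym (e x y)

atLeast-compositions : (P : Property) → Hereditary P → ∀ {N} (G : OGraph N) → P G → ∀ k n →
  tGeq G k (n + 3) → 2 + k * 4 ≤ n → AtLeast P n ((n ∸ (2 + k * 4) + k) C k)
atLeast-compositions P hered {N} G PG k n (b , binj , bprop) le = g , Pg , dist
  where
  open Blocks G k n b binj bprop
  T : ℕ
  T = n ∸ (2 + k * 4)
  cf : Fin ((T + k) C k) → Fin k → ℕ
  cf i = composition k T i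
  cb : ∀ i t → cf i t + 2 ≤ l (σ t)
  cb i t = ≤-trans (+-monoˡ-≤ 2 (≤-trans (term≤sumF (cf i) t) (≤-trans (composition-sum≤ k T i) (m∸n≤m n (2 + k * 4)))))
             (≤-trans (+-monoʳ-≤ n (n≤1+n 2)) (n+3≤l (σ t)))
  hb : ∀ i → rank (chosen (cf i) 2) N ≤ n
  hb i = ≤-trans (rank-chosen (cf i)) (≤-trans (+-monoʳ-≤ 2 (+-monoˡ-≤ (k * 4) (composition-sum≤ k T i)))
          (≤-reflexive (trans (+-comm 2 (T + k * 4)) (trans (+-assoc T (k * 4) 2)
            (trans (cong (T +_) (+-comm (k * 4) 2)) (m∸n+n≡m le))))))
  g : Fin ((T + k) C k) → OGraph n
  g i = familyGraph (cf i) (cb i) (hb i)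
  Pg : ∀ i → P (g i)
  Pg i = proj₂ hered G (Selection.embed G (chosen (cf i) (lastLength (cf i) (cb i))) n (rank-chosen-last (cf i) (cb i) (hb i))) (Selection.embed-increasing G (chosen (cf i) (lastLength (cf i) (cb i))) n (rank-chosen-last (cf i) (cb i) (hb i))) PG
  dist : ∀ i j → i ≢ j → ¬ (g i ≈G g j)
  dist i j i≢j eqG = fin (argmin-among (λ t → cf i t ≢ cf j t) (λ t → ¬? (cf i t ≟ cf j t)) (λ t → a (σ t))
                          (¬∀⟶∃¬ k (λ t → cf i t ≡ cf j t) (λ t → cf i t ≟ cf j t) (λ all → i≢j (composition-injective k T i j all))))
    where
    fin : (Σ (Fin k) λ t0 → (cf i t0 ≢ cf j t0) × (∀ t → cf i t ≢ cf j t → a (σ t0) ≤ a (σ t))) → ⊥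
    fin (t0 , q0 , mn) = cmp (<-cmp (cf i t0) (cf j t0))
      where
      cmp : Tri (cf i t0 < cf j t0) (cf i t0 ≡ cf j t0) (cf j t0 < cf i t0) → ⊥
      cmp (tri< lt _ _) = Separation.distinct (cf i) (cf j) (cb i) (cb j) (hb i) (hb j) t0 lt mn eqG
      cmp (tri≈ _ e _) = q0 e
      cmp (tri> _ _ gt) = Separation.distinct (cf j) (cf i) (cb j) (cb i) (hb j) (hb i) t0 gt (λ t ne → mn t (λ e → ne (sym e))) (≈G-sym {n} {g i} {g j} eqG)

-- Layouts for k = 1

data Part : Set where
  inB inD atV₁ atV₂ : Part

-- A segment (s , ℓ , K) is the run s, s+1, …, s+ℓ−1 of vertices of part K; a
-- layout (a list of segments) stands for the induced graph on the concatenated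
-- runs. vertexAt and partAt return junk beyond the size of the layout.
Segment : Set
Segment = ℕ × ℕ × Part

size : List Segment → ℕ
size [] = 0
size ((s , ℓ , K) ∷ L) = ℓ + size L

vertexAt-case : ℕ → (ℓ : ℕ) → List Segment → (p : ℕ) → Dec (p < ℓ) → ℕ
vertexAt : List Segment → ℕ → ℕ
vertexAt [] p = 0
vertexAt ((s , ℓ , K) ∷ L) p = vertexAt-case s ℓ L p (p <? ℓ)
vertexAt-case s ℓ L p (yes _) = s + p
vertexAt-case s ℓ L p (no _) = vertexAt L (p ∸ ℓ)

partAt-case : Part → (ℓ : ℕ) → List Segment → (p : ℕ) → Dec (p < ℓ) → Part
partAt : List Segment → ℕ → Part
partAt [] p = inB
partAt ((s , ℓ , K) ∷ L) p = partAt-case K ℓ L p (p <? ℓ)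
partAt-case K ℓ L p (yes _) = K
partAt-case K ℓ L p (no _) = partAt L (p ∸ ℓ)

partAt-here : ∀ s ℓ K L p → p < ℓ → partAt ((s , ℓ , K) ∷ L) p ≡ K
partAt-here s ℓ K L p lt with p <? ℓ
... | yes _ = refl
... | no ge = ⊥-elim (ge lt)

partAt-there : ∀ s ℓ K L p → ℓ ≤ p → partAt ((s , ℓ , K) ∷ L) p ≡ partAt L (p ∸ ℓ)
partAt-there s ℓ K L p le with p <? ℓ
... | yes lt = ⊥-elim (<⇒≱ lt le)
... | no _ = refl

Ascending : ℕ → List Segment → ℕ → Set
Ascending lo [] hi = lo ≤ hi
Ascending lo ((s , ℓ , K) ∷ L) hi = lo ≤ s × Ascending (s + ℓ) L hi

Ascending⇒≤ : ∀ lo L hi → Ascending lo L hi → lo ≤ hi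
Ascending⇒≤ lo [] hi o = o
Ascending⇒≤ lo ((s , ℓ , K) ∷ L) hi (le , o) = ≤-trans le (≤-trans (m≤m+n s ℓ) (Ascending⇒≤ (s + ℓ) L hi o))

vertexAt-bounds : ∀ lo L hi → Ascending lo L hi → ∀ p → p < size L → lo ≤ vertexAt L p × vertexAt L p < hi
vertexAt-bounds lo ((s , ℓ , K) ∷ L) hi (le , o) p lt with p <? ℓ
... | yes pl = ≤-trans le (m≤m+n s p) , <-≤-trans (+-monoʳ-< s pl) (Ascending⇒≤ (s + ℓ) L hi o)
... | no pg = let (b1 , b2) = vertexAt-bounds (s + ℓ) L hi o (p ∸ ℓ) (subst (p ∸ ℓ <_) (m+n∸m≡n ℓ (size L)) (∸-monoˡ-< lt (≮⇒≥ pg)))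
              in ≤-trans le (≤-trans (m≤m+n s ℓ) b1) , b2

vertexAt-increasing : ∀ lo L hi → Ascending lo L hi → ∀ p q → p < q → q < size L → vertexAt L p < vertexAt L q
vertexAt-increasing lo ((s , ℓ , K) ∷ L) hi (le , o) p q pq qt with p <? ℓ | q <? ℓ
... | yes _ | yes _ = +-monoʳ-< s pq
... | yes pl | no qg = <-≤-trans (+-monoʳ-< s pl) (proj₁ (vertexAt-bounds (s + ℓ) L hi o (q ∸ ℓ)
                          (subst (q ∸ ℓ <_) (m+n∸m≡n ℓ (size L)) (∸-monoˡ-< qt (≮⇒≥ qg)))))
... | no pg | yes ql = ⊥-elim (pg (<-trans pq ql))
... | no pg | no qg = vertexAt-increasing (s + ℓ) L hi o (p ∸ ℓ) (q ∸ ℓ) (∸-monoˡ-< pq (≮⇒≥ pg))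
                          (subst (q ∸ ℓ <_) (m+n∸m≡n ℓ (size L)) (∸-monoˡ-< qt (≮⇒≥ qg)))

vertexAt-injective : ∀ lo L hi → Ascending lo L hi → ∀ p q → p < size L → q < size L → p ≢ q → vertexAt L p ≢ vertexAt L q
vertexAt-injective lo L hi o p q p<L q<L ne e with <-cmp p q
... | tri< lt _ _ = <-irrefl e (vertexAt-increasing lo L hi o p q lt q<L)
... | tri≈ _ eq _ = ne eq
... | tri> _ _ gt = <-irrefl (sym e) (vertexAt-increasing lo L hi o q p gt p<L)

Conforms : (Part → ℕ → Set) → List Segment → Set
Conforms InPart [] = ⊤
Conforms InPart ((s , ℓ , K) ∷ L) = (∀ o → o < ℓ → InPart K (s + o)) × Conforms InPart L

vertexAt-conforms : ∀ InPart L → Conforms InPart L → ∀ p → p < size L → InPart (partAt L p) (vertexAt L p)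
vertexAt-conforms InPart ((s , ℓ , K) ∷ L) (h , so) p lt with p <? ℓ
... | yes pl = h p pl
... | no pg = vertexAt-conforms InPart L so (p ∸ ℓ) (subst (p ∸ ℓ <_) (m+n∸m≡n ℓ (size L)) (∸-monoˡ-< lt (≮⇒≥ pg)))

module Layout {N : ℕ} (G : OGraph N) (L : List Segment) (ord : Ascending 0 L N) (n : ℕ) (tn : size L ≡ n) where
  vertex<N : (p : Fin n) → vertexAt L (toℕ p) < N
  vertex<N p = proj₂ (vertexAt-bounds 0 L N ord (toℕ p) (subst (toℕ p <_) (sym tn) (toℕ<n p)))

  embed : Fin n → Fin N
  embed p = fromℕ< (vertex<N p)

  embed-increasing : StrictlyIncreasing embed
  embed-increasing i j lt = subst₂ _<_ (sym (toℕ-fromℕ< (vertex<N i))) (sym (toℕ-fromℕ< (vertex<N j)))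
    (vertexAt-increasing 0 L N ord (toℕ i) (toℕ j) lt (subst (toℕ j <_) (sym tn) (toℕ<n j)))

  graph : OGraph n
  graph = induced G embed embed-increasing

  graph-adj : ∀ p q → adj graph p q ≡ adjℕ G (vertexAt L (toℕ p)) (vertexAt L (toℕ q))
  graph-adj p q = sym (adjℕ-fromℕ< G _ _ (vertex<N p) (vertex<N q))

module TwoBlocks {N : ℕ} (G : OGraph N) (a LB c LD v1 v2 : ℕ)
  (HBi : HomInterval G a LB) (HDi : HomInterval G c LD) (LB2 : 2 ≤ LB) (LD2 : 2 ≤ LD)
  (disj : ∀ v → Within a LB v → Within c LD v → ⊥)
  (v1B : ¬ Within a LB v1) (v1D : ¬ Within c LD v1) (v2B : ¬ Within a LB v2) (v2D : ¬ Within c LD v2) where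

  InPart : Part → ℕ → Set
  InPart inB v = Within a LB v
  InPart inD v = Within c LD v
  InPart atV₁ v = v ≡ v1
  InPart atV₂ v = v ≡ v2

  tB : Bool
  tB = adjℕ G a (suc a)
  tD : Bool
  tD = adjℕ G c (suc c)
  e : Bool
  e = adjℕ G a c

  shape : Part → Part → Bool
  shape inB inB = tB
  shape inD inD = tD
  shape inB inD = e
  shape inD inB = e
  shape inB atV₁ = adjℕ G a v1
  shape atV₁ inB = adjℕ G a v1
  shape inD atV₁ = adjℕ G c v1
  shape atV₁ inD = adjℕ G c v1
  shape inB atV₂ = adjℕ G a v2
  shape atV₂ inB = adjℕ G a v2
  shape inD atV₂ = adjℕ G c v2
  shape atV₂ inD = adjℕ G c v2
  shape atV₁ atV₂ = adjℕ G v1 v2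
  shape atV₂ atV₁ = adjℕ G v1 v2
  shape atV₁ atV₁ = false
  shape atV₂ atV₂ = false

  first-two : ∀ s L → 2 ≤ L → Within s L s × Within s L (suc s)
  first-two s L le = (≤-refl , ≤-trans (≤-reflexive (+-comm 1 s)) (+-monoʳ-≤ s (≤-trans (s≤s z≤n) le))) ,
               (n≤1+n s , ≤-trans (≤-reflexive (+-comm 2 s)) (+-monoʳ-≤ s le))

  aB : Within a LB a
  aB = proj₁ (first-two a LB LB2)
  saB : Within a LB (suc a)
  saB = proj₂ (first-two a LB LB2)
  cD : Within c LD c
  cD = proj₁ (first-two c LD LD2)
  scD : Within c LD (suc c)
  scD = proj₂ (first-two c LD LD2)

  adj-B-outside : ∀ x w → Within a LB x → ¬ Within a LB w → adjℕ G x w ≡ adjℕ G a w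
  adj-B-outside x w ix nw = hom-adjℕ G a LB HBi x a w ix aB (λ e → nw (subst (Within a LB) (sym e) ix)) (λ e → nw (subst (Within a LB) (sym e) aB))

  adj-D-outside : ∀ x w → Within c LD x → ¬ Within c LD w → adjℕ G x w ≡ adjℕ G c w
  adj-D-outside x w ix nw = hom-adjℕ G c LD HDi x c w ix cD (λ e → nw (subst (Within c LD) (sym e) ix)) (λ e → nw (subst (Within c LD) (sym e) cD))

  adj-B-D : ∀ x y → Within a LB x → Within c LD y → adjℕ G x y ≡ e
  adj-B-D x y ix iy = trans (adj-B-outside x y ix (λ yB → disj y yB iy))
    (trans (adjℕ-sym G a y) (trans (adj-D-outside y a iy (λ aD → disj a aB aD)) (adjℕ-sym G c a)))

  aneq : ∀ s → s ≢ suc s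
  aneq s eq = <-irrefl eq (n<1+n s)

  adj-shape : ∀ K K' v v' → InPart K v → InPart K' v' → v ≢ v' → adjℕ G v v' ≡ shape K K'
  adj-shape inB inB v v' iv iv' ne = hom-pairs G a LB HBi v v' a (suc a) iv iv' aB saB ne (aneq a)
  adj-shape inD inD v v' iv iv' ne = hom-pairs G c LD HDi v v' c (suc c) iv iv' cD scD ne (aneq c)
  adj-shape inB inD v v' iv iv' ne = adj-B-D v v' iv iv'
  adj-shape inD inB v v' iv iv' ne = trans (adjℕ-sym G v v') (adj-B-D v' v iv' iv)
  adj-shape inB atV₁ v v' iv refl ne = adj-B-outside v v1 iv v1B
  adj-shape atV₁ inB v v' refl iv' ne = trans (adjℕ-sym G v1 v') (adj-B-outside v' v1 iv' v1B)
  adj-shape inD atV₁ v v' iv refl ne = adj-D-outside v v1 iv v1D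
  adj-shape atV₁ inD v v' refl iv' ne = trans (adjℕ-sym G v1 v') (adj-D-outside v' v1 iv' v1D)
  adj-shape inB atV₂ v v' iv refl ne = adj-B-outside v v2 iv v2B
  adj-shape atV₂ inB v v' refl iv' ne = trans (adjℕ-sym G v2 v') (adj-B-outside v' v2 iv' v2B)
  adj-shape inD atV₂ v v' iv refl ne = adj-D-outside v v2 iv v2D
  adj-shape atV₂ inD v v' refl iv' ne = trans (adjℕ-sym G v2 v') (adj-D-outside v' v2 iv' v2D)
  adj-shape atV₁ atV₂ v v' refl refl ne = refl
  adj-shape atV₂ atV₁ v v' refl refl ne = adjℕ-sym G v2 v1
  adj-shape atV₁ atV₁ v v' refl refl ne = ⊥-elim (ne refl)
  adj-shape atV₂ atV₂ v v' refl refl ne = ⊥-elim (ne refl)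

  Separates : ∀ n → (Fin n → List Segment) → Fin n → Fin n → Set
  Separates n lay i j = Σ ℕ λ p → Σ ℕ λ q → p < n × q < n × p ≢ q ×
           shape (partAt (lay i) p) (partAt (lay i) q) ≢ shape (partAt (lay j) p) (partAt (lay j) q)

  atLeast-layouts : (P : Property) → Hereditary P → P G → ∀ n (lay : Fin n → List Segment)
    (ord : ∀ i → Ascending 0 (lay i) N) (tn : ∀ i → size (lay i) ≡ n) (sok : ∀ i → Conforms InPart (lay i))
    (sep : ∀ i j → toℕ i < toℕ j → Separates n lay i j) → AtLeast P n n
  atLeast-layouts P hered PG n lay ord tn sok sep = g , (λ i → proj₂ hered G (Layout.embed G (lay i) (ord i) n (tn i)) (Layout.embed-increasing G (lay i) (ord i) n (tn i)) PG) , dist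
    where
    g : Fin n → OGraph n
    g i = Layout.graph G (lay i) (ord i) n (tn i)
    adj-layout : ∀ i p q → (P' : p < n) (Q' : q < n) → p ≢ q →
      adj (g i) (fromℕ< P') (fromℕ< Q') ≡ shape (partAt (lay i) p) (partAt (lay i) q)
    adj-layout i p q P' Q' ne = trans (Layout.graph-adj G (lay i) (ord i) n (tn i) (fromℕ< P') (fromℕ< Q'))
      (trans (cong₂ (λ x y → adjℕ G (vertexAt (lay i) x) (vertexAt (lay i) y)) (toℕ-fromℕ< P') (toℕ-fromℕ< Q'))
        (adj-shape _ _ _ _ (vertexAt-conforms InPart (lay i) (sok i) p pt′) (vertexAt-conforms InPart (lay i) (sok i) q qt′)
           (vertexAt-injective 0 (lay i) N (ord i) p q pt′ qt′ ne)))
      where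
      pt′ : p < size (lay i)
      pt′ = subst (p <_) (sym (tn i)) P'
      qt′ : q < size (lay i)
      qt′ = subst (q <_) (sym (tn i)) Q'
    sep' : ∀ i j → toℕ i < toℕ j → ¬ (g i ≈G g j)
    sep' i j lt eqG with sep i j lt
    ... | (p , q , P' , Q' , ne , kne) = kne (trans (sym (adj-layout i p q P' Q' ne)) (trans (eqG (fromℕ< P') (fromℕ< Q')) (adj-layout j p q P' Q' ne)))
    dist : ∀ i j → i ≢ j → ¬ (g i ≈G g j)
    dist i j ne eqG with <-cmp (toℕ i) (toℕ j)
    ... | tri< lt _ _ = sep' i j lt eqG
    ... | tri≈ _ e _ = ne (toℕ-injective e)
    ... | tri> _ _ gt = sep' j i gt (λ x y → sym (eqG x y))

-- Each family lays out an initial segment of B whose length j varies with the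
-- member, an initial segment of D and at most two single vertices v1, v2 (v1 is
-- dropped when there is no room for it). Two members j < j' are told apart by
-- the adjacency of one pair of positions, which is where the hypothesis of the
-- family is used.
module TwoBlockFamilies {N : ℕ} (G : OGraph N) (n a LB c LD v1 v2 : ℕ)
  (HBi : HomInterval G a LB) (HDi : HomInterval G c LD) (LB2 : 2 ≤ LB) (LD2 : 2 ≤ LD)
  (disj : ∀ v → Within a LB v → Within c LD v → ⊥)
  (v1B : ¬ Within a LB v1) (v1D : ¬ Within c LD v1) (v2B : ¬ Within a LB v2) (v2D : ¬ Within c LD v2)
  (nLB : n ≤ LB) (nLD : n ≤ LD) (rc : a + LB ≤ c) (cN : c + LD ≤ N)
  (P : Property) (hered : Hereditary P) (PG : P G) where

  open TwoBlocks G a LB c LD v1 v2 HBi HDi LB2 LD2 disj v1B v1D v2B v2D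

  B-seg : ℕ → Segment
  B-seg j = a , j , inB
  D-seg : ℕ → Segment
  D-seg m = c , m , inD
  v1-seg : ℕ → Segment
  v1-seg ℓ = v1 , ℓ , atV₁
  v2-seg : Segment
  v2-seg = v2 , 1 , atV₂

  B-seg-conforms : ∀ j → j ≤ LB → ∀ o → o < j → InPart inB (a + o)
  B-seg-conforms j le o lt = m≤m+n a o , +-monoʳ-< a (<-≤-trans lt le)
  D-seg-conforms : ∀ m → m ≤ LD → ∀ o → o < m → InPart inD (c + o)
  D-seg-conforms m le o lt = m≤m+n c o , +-monoʳ-< c (<-≤-trans lt le)
  v1-seg-conforms : ∀ ℓ → ℓ ≤ 1 → ∀ o → o < ℓ → InPart atV₁ (v1 + o)
  v1-seg-conforms ℓ le zero lt = +-identityʳ v1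
  v1-seg-conforms ℓ le (suc o) lt = ⊥-elim (1+n≰n (≤-trans lt (≤-trans le (s≤s z≤n))))
  v2-seg-conforms : ∀ o → o < 1 → InPart atV₂ (v2 + o)
  v2-seg-conforms zero lt = +-identityʳ v2
  v2-seg-conforms (suc o) (s≤s ())

  shape-≢ : ∀ {K1 K2 K3 K4 X1 X2 X3 X4} → K1 ≡ X1 → K2 ≡ X2 → K3 ≡ X3 → K4 ≡ X4 → shape X1 X2 ≢ shape X3 X4 → shape K1 K2 ≢ shape K3 K4
  shape-≢ refl refl refl refl ne = ne

  j≤n∸1 : ∀ {j} → j < n → j ≤ n ∸ 1
  j≤n∸1 lt = ∸-monoˡ-≤ 1 lt
  n∸1<n : ∀ {j} → j < n → n ∸ 1 < n
  n∸1<n {j} lt = subst (_< n) (sym (+-∸-assoc 0 (≤-trans (s≤s z≤n) lt))) (∸-monoʳ-< (s≤s z≤n) (≤-trans (s≤s z≤n) lt))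

  p∸x<y : ∀ {p x y} → p < x + y → x ≤ p → p ∸ x < y
  p∸x<y {p} {x} {y} lt le = subst (p ∸ x <_) (m+n∸m≡n x y) (∸-monoˡ-< lt le)

  partAt-2nd : ∀ s1 ℓ1 K1 s ℓ K L2 p → ℓ1 ≤ p → p < ℓ1 + ℓ → partAt ((s1 , ℓ1 , K1) ∷ (s , ℓ , K) ∷ L2) p ≡ K
  partAt-2nd s1 ℓ1 K1 s ℓ K L2 p le lt = trans (partAt-there s1 ℓ1 K1 _ p le) (partAt-here s ℓ K L2 (p ∸ ℓ1) (p∸x<y lt le))

  partAt-3rd : ∀ s1 ℓ1 K1 s2 ℓ2 K2 s ℓ K L2 p → ℓ1 + ℓ2 ≤ p → p < ℓ1 + ℓ2 + ℓ →
    partAt ((s1 , ℓ1 , K1) ∷ (s2 , ℓ2 , K2) ∷ (s , ℓ , K) ∷ L2) p ≡ K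
  partAt-3rd s1 ℓ1 K1 s2 ℓ2 K2 s ℓ K L2 p le lt =
    trans (partAt-there s1 ℓ1 K1 _ p (≤-trans (m≤m+n ℓ1 ℓ2) le))
      (partAt-2nd s2 ℓ2 K2 s ℓ K L2 (p ∸ ℓ1) (≤-trans (≤-reflexive (sym (m+n∸m≡n ℓ1 ℓ2))) (∸-monoˡ-≤ ℓ1 le))
        (p∸x<y (subst (p <_) (+-assoc ℓ1 ℓ2 ℓ) lt) (≤-trans (m≤m+n ℓ1 ℓ2) le)))

  partAt-4th : ∀ s1 ℓ1 K1 s2 ℓ2 K2 s3 ℓ3 K3 s ℓ K L2 p → ℓ1 + ℓ2 + ℓ3 ≤ p → p < ℓ1 + ℓ2 + ℓ3 + ℓ →
    partAt ((s1 , ℓ1 , K1) ∷ (s2 , ℓ2 , K2) ∷ (s3 , ℓ3 , K3) ∷ (s , ℓ , K) ∷ L2) p ≡ K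
  partAt-4th s1 ℓ1 K1 s2 ℓ2 K2 s3 ℓ3 K3 s ℓ K L2 p le lt =
    trans (partAt-there s1 ℓ1 K1 _ p (≤-trans (≤-trans (m≤m+n ℓ1 ℓ2) (m≤m+n _ ℓ3)) le))
      (partAt-3rd s2 ℓ2 K2 s3 ℓ3 K3 s ℓ K L2 (p ∸ ℓ1)
        (≤-trans (≤-reflexive (sym (trans (cong (_∸ ℓ1) (+-assoc ℓ1 ℓ2 ℓ3)) (m+n∸m≡n ℓ1 _)))) (∸-monoˡ-≤ ℓ1 le))
        (p∸x<y (subst (p <_) (trans (cong (_+ ℓ) (+-assoc ℓ1 ℓ2 ℓ3)) (trans (+-assoc ℓ1 (ℓ2 + ℓ3) ℓ) (cong (ℓ1 +_) (refl)))) lt)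
             (≤-trans (≤-trans (m≤m+n ℓ1 ℓ2) (m≤m+n _ ℓ3)) le)))

  atLeast-BD⁺ : e ≢ tB → AtLeast P n n
  atLeast-BD⁺ ne = atLeast-layouts P hered PG n lay ord tn sok sep
    where
    Jx : Fin n → ℕ
    Jx jj = suc (toℕ jj)
    lay : Fin n → List Segment
    lay jj = B-seg (Jx jj) ∷ D-seg (n ∸ Jx jj) ∷ []
    ord : ∀ jj → Ascending 0 (lay jj) N
    ord jj = z≤n , ≤-trans (+-monoʳ-≤ a (≤-trans (toℕ<n jj) nLB)) rc ,
             ≤-trans (+-monoʳ-≤ c (≤-trans (m∸n≤m n (Jx jj)) nLD)) cN
    tn : ∀ jj → size (lay jj) ≡ n
    tn jj = trans (cong (Jx jj +_) (+-identityʳ _)) (m+[n∸m]≡n (toℕ<n jj))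
    sok : ∀ jj → Conforms InPart (lay jj)
    sok jj = B-seg-conforms (Jx jj) (≤-trans (toℕ<n jj) nLB) , D-seg-conforms _ (≤-trans (m∸n≤m n (Jx jj)) nLD) , tt
    sep : ∀ i j → toℕ i < toℕ j → Separates n lay i j
    sep i i' lt = 0 , Jx i , ≤-trans (s≤s z≤n) (toℕ<n i) , Jn , (λ ()) ,
      shape-≢ (partAt-here a (Jx i) inB (D-seg (n ∸ Jx i) ∷ []) 0 (s≤s z≤n))
           (partAt-2nd a (Jx i) inB c (n ∸ Jx i) inD [] (Jx i) ≤-refl (subst (Jx i <_) (sym (m+[n∸m]≡n (toℕ<n i))) Jn))
           (partAt-here a (Jx i') inB (D-seg (n ∸ Jx i') ∷ []) 0 (s≤s z≤n))
           (partAt-here a (Jx i') inB (D-seg (n ∸ Jx i') ∷ []) (Jx i) (s≤s lt))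
           ne
      where
      Jn : Jx i < n
      Jn = <-≤-trans (s≤s lt) (toℕ<n i')

  atLeast-BD : tD ≢ e → AtLeast P n n
  atLeast-BD ne = atLeast-layouts P hered PG n lay ord tn sok sep
    where
    lay : Fin n → List Segment
    lay jj = B-seg (toℕ jj) ∷ D-seg (n ∸ toℕ jj) ∷ []
    ord : ∀ jj → Ascending 0 (lay jj) N
    ord jj = z≤n , ≤-trans (+-monoʳ-≤ a (≤-trans (<⇒≤ (toℕ<n jj)) nLB)) rc ,
             ≤-trans (+-monoʳ-≤ c (≤-trans (m∸n≤m n (toℕ jj)) nLD)) cN
    tn : ∀ jj → size (lay jj) ≡ n
    tn jj = trans (cong (toℕ jj +_) (+-identityʳ _)) (m+[n∸m]≡n (<⇒≤ (toℕ<n jj)))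
    sok : ∀ jj → Conforms InPart (lay jj)
    sok jj = B-seg-conforms (toℕ jj) (≤-trans (<⇒≤ (toℕ<n jj)) nLB) , D-seg-conforms _ (≤-trans (m∸n≤m n (toℕ jj)) nLD) , tt
    sep : ∀ i j → toℕ i < toℕ j → Separates n lay i j
    sep i i' lt = j , n ∸ 1 , toℕ<n i , n∸1<n (toℕ<n i) , (λ e → <-irrefl e j<q) ,
      shape-≢ (partAt-2nd a j inB c (n ∸ j) inD [] j ≤-refl (subst (j <_) (sym (m+[n∸m]≡n (<⇒≤ (toℕ<n i)))) (toℕ<n i)))
           (partAt-2nd a j inB c (n ∸ j) inD [] (n ∸ 1) (<⇒≤ j<q) (subst (n ∸ 1 <_) (sym (m+[n∸m]≡n (<⇒≤ (toℕ<n i)))) (n∸1<n (toℕ<n i))))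
           (partAt-here a j' inB (D-seg (n ∸ j') ∷ []) j lt)
           (partAt-2nd a j' inB c (n ∸ j') inD [] (n ∸ 1) (j≤n∸1 (toℕ<n i')) (subst (n ∸ 1 <_) (sym (m+[n∸m]≡n (<⇒≤ (toℕ<n i')))) (n∸1<n (toℕ<n i))))
           ne
      where
      j : ℕ
      j = toℕ i
      j' : ℕ
      j' = toℕ i'
      j<q : j < n ∸ 1
      j<q = <-≤-trans lt (j≤n∸1 (toℕ<n i'))

  atLeast-wBD : suc v1 ≤ a → adjℕ G c v1 ≢ adjℕ G a v1 → AtLeast P n n
  atLeast-wBD v1a ne = atLeast-layouts P hered PG n lay ord tn sok sep
    where
    lay : Fin n → List Segment
    lay jj = v1-seg 1 ∷ B-seg (toℕ jj) ∷ D-seg (n ∸ suc (toℕ jj)) ∷ []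
    ord : ∀ jj → Ascending 0 (lay jj) N
    ord jj = z≤n , ≤-trans (≤-reflexive (+-comm v1 1)) v1a , ≤-trans (+-monoʳ-≤ a (≤-trans (<⇒≤ (toℕ<n jj)) nLB)) rc ,
             ≤-trans (+-monoʳ-≤ c (≤-trans (m∸n≤m n (suc (toℕ jj))) nLD)) cN
    tn : ∀ jj → size (lay jj) ≡ n
    tn jj = trans (cong (λ x → suc (toℕ jj + x)) (+-identityʳ _)) (m+[n∸m]≡n (toℕ<n jj))
    sok : ∀ jj → Conforms InPart (lay jj)
    sok jj = v1-seg-conforms 1 ≤-refl , B-seg-conforms (toℕ jj) (≤-trans (<⇒≤ (toℕ<n jj)) nLB) , D-seg-conforms _ (≤-trans (m∸n≤m n (suc (toℕ jj))) nLD) , tt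
    sep : ∀ i j → toℕ i < toℕ j → Separates n lay i j
    sep i i' lt = 0 , j' , ≤-trans (s≤s z≤n) (toℕ<n i) , toℕ<n i' , (λ e → <-irrefl e (≤-<-trans z≤n lt)) ,
      shape-≢ (partAt-here v1 1 atV₁ (B-seg j ∷ D-seg (n ∸ suc j) ∷ []) 0 (s≤s z≤n))
           (partAt-3rd v1 1 atV₁ a j inB c (n ∸ suc j) inD [] j' lt (subst (j' <_) (sym (m+[n∸m]≡n (toℕ<n i))) (toℕ<n i')))
           (partAt-here v1 1 atV₁ (B-seg j' ∷ D-seg (n ∸ suc j') ∷ []) 0 (s≤s z≤n))
           (partAt-2nd v1 1 atV₁ a j' inB (D-seg (n ∸ suc j') ∷ []) j' (≤-trans (s≤s z≤n) lt) (n<1+n j'))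
           ne
      where
      j : ℕ
      j = toℕ i
      j' : ℕ
      j' = toℕ i'

  atLeast-BwD : a + LB ≤ v1 → suc v1 ≤ c → adjℕ G c v1 ≢ adjℕ G a v1 → AtLeast P n n
  atLeast-BwD av1 v1c ne = atLeast-layouts P hered PG n lay ord tn sok sep
    where
    lay : Fin n → List Segment
    lay jj = B-seg (toℕ jj) ∷ v1-seg 1 ∷ D-seg (n ∸ suc (toℕ jj)) ∷ []
    ord : ∀ jj → Ascending 0 (lay jj) N
    ord jj = z≤n , ≤-trans (+-monoʳ-≤ a (≤-trans (<⇒≤ (toℕ<n jj)) nLB)) av1 , ≤-trans (≤-reflexive (+-comm v1 1)) v1c ,
             ≤-trans (+-monoʳ-≤ c (≤-trans (m∸n≤m n (suc (toℕ jj))) nLD)) cN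
    tn : ∀ jj → size (lay jj) ≡ n
    tn jj = trans (cong (λ x → toℕ jj + suc x) (+-identityʳ _)) (trans (+-suc (toℕ jj) _) (m+[n∸m]≡n (toℕ<n jj)))
    sok : ∀ jj → Conforms InPart (lay jj)
    sok jj = B-seg-conforms (toℕ jj) (≤-trans (<⇒≤ (toℕ<n jj)) nLB) , v1-seg-conforms 1 ≤-refl , D-seg-conforms _ (≤-trans (m∸n≤m n (suc (toℕ jj))) nLD) , tt
    sep : ∀ i j → toℕ i < toℕ j → Separates n lay i j
    sep i i' lt = j , j' , toℕ<n i , toℕ<n i' , (λ e → <-irrefl e lt) ,
      shape-≢ (partAt-2nd a j inB v1 1 atV₁ (D-seg (n ∸ suc j) ∷ []) j ≤-refl (≤-reflexive (+-comm 1 j)))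
           (partAt-3rd a j inB v1 1 atV₁ c (n ∸ suc j) inD [] j' (≤-trans (≤-reflexive (+-comm j 1)) lt)
              (subst (j' <_) (sym (trans (cong (_+ (n ∸ suc j)) (+-comm j 1)) (m+[n∸m]≡n (toℕ<n i)))) (toℕ<n i')))
           (partAt-here a j' inB (v1-seg 1 ∷ D-seg (n ∸ suc j') ∷ []) j lt)
           (partAt-2nd a j' inB v1 1 atV₁ (D-seg (n ∸ suc j') ∷ []) j' ≤-refl (≤-reflexive (+-comm 1 j')))
           (λ e → ne (trans e refl))
      where
      j : ℕ
      j = toℕ i
      j' : ℕ
      j' = toℕ i'

  atLeast-BDw : c + LD ≤ v1 → suc v1 ≤ N → adjℕ G c v1 ≢ adjℕ G a v1 → AtLeast P n n
  atLeast-BDw cv1 v1N ne = atLeast-layouts P hered PG n lay ord tn sok sep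
    where
    lay : Fin n → List Segment
    lay jj = B-seg (toℕ jj) ∷ D-seg (n ∸ suc (toℕ jj)) ∷ v1-seg 1 ∷ []
    ord : ∀ jj → Ascending 0 (lay jj) N
    ord jj = z≤n , ≤-trans (+-monoʳ-≤ a (≤-trans (<⇒≤ (toℕ<n jj)) nLB)) rc ,
             ≤-trans (+-monoʳ-≤ c (≤-trans (m∸n≤m n (suc (toℕ jj))) nLD)) cv1 , ≤-trans (≤-reflexive (+-comm v1 1)) v1N
    tn : ∀ jj → size (lay jj) ≡ n
    tn jj = trans (cong (toℕ jj +_) (+-comm (n ∸ suc (toℕ jj)) 1)) (trans (+-suc (toℕ jj) _) (m+[n∸m]≡n (toℕ<n jj)))
    sok : ∀ jj → Conforms InPart (lay jj)
    sok jj = B-seg-conforms (toℕ jj) (≤-trans (<⇒≤ (toℕ<n jj)) nLB) , D-seg-conforms _ (≤-trans (m∸n≤m n (suc (toℕ jj))) nLD) , v1-seg-conforms 1 ≤-refl , tt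
    eqn1 : ∀ j → j < n → j + (n ∸ suc j) ≡ n ∸ 1
    eqn1 j lt = cong (_∸ 1) (m+[n∸m]≡n lt)
    sep : ∀ i j → toℕ i < toℕ j → Separates n lay i j
    sep i i' lt = j , n ∸ 1 , toℕ<n i , n∸1<n (toℕ<n i) , (λ e → <-irrefl e j<q) ,
      shape-≢ (partAt-2nd a j inB c (n ∸ suc j) inD (v1-seg 1 ∷ []) j ≤-refl (subst (j <_) (sym (eqn1 j (toℕ<n i))) j<q))
           (partAt-3rd a j inB c (n ∸ suc j) inD v1 1 atV₁ [] (n ∸ 1) (≤-reflexive (eqn1 j (toℕ<n i)))
              (subst (n ∸ 1 <_) (sym (cong (_+ 1) (eqn1 j (toℕ<n i)))) (≤-reflexive (+-comm 1 (n ∸ 1)))))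
           (partAt-here a j' inB (D-seg (n ∸ suc j') ∷ v1-seg 1 ∷ []) j lt)
           (partAt-3rd a j' inB c (n ∸ suc j') inD v1 1 atV₁ [] (n ∸ 1) (≤-reflexive (eqn1 j' (toℕ<n i')))
              (subst (n ∸ 1 <_) (sym (cong (_+ 1) (eqn1 j' (toℕ<n i')))) (≤-reflexive (+-comm 1 (n ∸ 1)))))
           ne
      where
      j : ℕ
      j = toℕ i
      j' : ℕ
      j' = toℕ i'
      j<q : j < n ∸ 1
      j<q = <-≤-trans lt (j≤n∸1 (toℕ<n i'))

  j<n∸1⇒1+j<n : ∀ m j → j < m ∸ 1 → suc j < m
  j<n∸1⇒1+j<n zero j ()
  j<n∸1⇒1+j<n (suc m) j lt = s≤s lt

  1+[n∸1]≡n : ∀ m j → j < m → suc (m ∸ 1) ≡ m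
  1+[n∸1]≡n (suc m) j lt = refl

  j≡n∸1 : ∀ {j} → j < n → ¬ j < n ∸ 1 → j ≡ n ∸ 1
  j≡n∸1 lt nl = ≤-antisym (j≤n∸1 lt) (≮⇒≥ nl)

  1+j+[n∸2∸j]≡n∸1 : ∀ {j} → j < n ∸ 1 → suc j + (n ∸ suc (suc j)) ≡ n ∸ 1
  1+j+[n∸2∸j]≡n∸1 {j} lt = cong (_∸ 1) (m+[n∸m]≡n (j<n∸1⇒1+j<n n j lt))

  j+1+[n∸2∸j]≡n∸1 : ∀ {j} → j < n ∸ 1 → j + 1 + (n ∸ suc (suc j)) ≡ n ∸ 1
  j+1+[n∸2∸j]≡n∸1 {j} lt = trans (cong (_+ (n ∸ suc (suc j))) (+-comm j 1)) (1+j+[n∸2∸j]≡n∸1 lt)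

  layY : ∀ j → Dec (j < n ∸ 1) → List Segment
  layY j (yes _) = B-seg j ∷ v1-seg 1 ∷ D-seg (n ∸ suc j) ∷ []
  layY j (no _) = B-seg n ∷ v1-seg 0 ∷ D-seg 0 ∷ []

  atLeast-BvD : a + LB ≤ v1 → suc v1 ≤ c → adjℕ G c v1 ≢ e → adjℕ G c v1 ≢ tB → AtLeast P n n
  atLeast-BvD av1 v1c ne1 ne2 = atLeast-layouts P hered PG n lay ord tn sok sep
    where
    lay : Fin n → List Segment
    lay jj = layY (toℕ jj) (toℕ jj <? n ∸ 1)
    ordY : ∀ j d → j < n → Ascending 0 (layY j d) N
    ordY j (yes p) lt = z≤n , ≤-trans (+-monoʳ-≤ a (≤-trans (<⇒≤ lt) nLB)) av1 , ≤-trans (≤-reflexive (+-comm v1 1)) v1c ,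
             ≤-trans (+-monoʳ-≤ c (≤-trans (m∸n≤m n (suc j)) nLD)) cN
    ordY j (no p) lt = z≤n , ≤-trans (+-monoʳ-≤ a nLB) av1 , ≤-trans (≤-reflexive (+-identityʳ v1)) (≤-trans (n≤1+n v1) v1c) ,
             ≤-trans (≤-reflexive (+-identityʳ c)) (≤-trans (m≤m+n c LD) cN)
    ord : ∀ jj → Ascending 0 (lay jj) N
    ord jj = ordY (toℕ jj) (toℕ jj <? n ∸ 1) (toℕ<n jj)
    tnY : ∀ j d → j < n → size (layY j d) ≡ n
    tnY j (yes p) lt = trans (cong (λ x → j + suc x) (+-identityʳ _)) (trans (+-suc j _) (m+[n∸m]≡n lt))
    tnY j (no p) lt = +-identityʳ n
    tn : ∀ jj → size (lay jj) ≡ n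
    tn jj = tnY (toℕ jj) (toℕ jj <? n ∸ 1) (toℕ<n jj)
    sokY : ∀ j d → j < n → Conforms InPart (layY j d)
    sokY j (yes p) lt = B-seg-conforms j (≤-trans (<⇒≤ lt) nLB) , v1-seg-conforms 1 ≤-refl , D-seg-conforms _ (≤-trans (m∸n≤m n (suc j)) nLD) , tt
    sokY j (no p) lt = B-seg-conforms n nLB , v1-seg-conforms 0 z≤n , D-seg-conforms 0 z≤n , tt
    sok : ∀ jj → Conforms InPart (lay jj)
    sok jj = sokY (toℕ jj) (toℕ jj <? n ∸ 1) (toℕ<n jj)
    sepY : ∀ j j' (d : Dec (j < n ∸ 1)) (d' : Dec (j' < n ∸ 1)) → j < j' → j' < n →
      shape (partAt (layY j d) j) (partAt (layY j d) (n ∸ 1)) ≢ shape (partAt (layY j' d') j) (partAt (layY j' d') (n ∸ 1))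
    sepY j j' (no nj) d' lt lt' = ⊥-elim (nj (<-≤-trans lt (j≤n∸1 lt')))
    sepY j j' (yes pj) (yes pj') lt lt' =
      shape-≢ (partAt-2nd a j inB v1 1 atV₁ (D-seg (n ∸ suc j) ∷ []) j ≤-refl (≤-reflexive (+-comm 1 j)))
           (partAt-3rd a j inB v1 1 atV₁ c (n ∸ suc j) inD [] (n ∸ 1) (≤-trans (≤-reflexive (+-comm j 1)) pj)
              (subst (n ∸ 1 <_) (sym (trans (cong (_+ (n ∸ suc j)) (+-comm j 1)) (m+[n∸m]≡n (<-trans lt lt')))) (n∸1<n lt')))
           (partAt-here a j' inB (v1-seg 1 ∷ D-seg (n ∸ suc j') ∷ []) j lt)
           (partAt-3rd a j' inB v1 1 atV₁ c (n ∸ suc j') inD [] (n ∸ 1) (≤-trans (≤-reflexive (+-comm j' 1)) pj')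
              (subst (n ∸ 1 <_) (sym (trans (cong (_+ (n ∸ suc j')) (+-comm j' 1)) (m+[n∸m]≡n lt'))) (n∸1<n lt')))
           ne1
    sepY j j' (yes pj) (no nj') lt lt' =
      shape-≢ (partAt-2nd a j inB v1 1 atV₁ (D-seg (n ∸ suc j) ∷ []) j ≤-refl (≤-reflexive (+-comm 1 j)))
           (partAt-3rd a j inB v1 1 atV₁ c (n ∸ suc j) inD [] (n ∸ 1) (≤-trans (≤-reflexive (+-comm j 1)) pj)
              (subst (n ∸ 1 <_) (sym (trans (cong (_+ (n ∸ suc j)) (+-comm j 1)) (m+[n∸m]≡n (<-trans lt lt')))) (n∸1<n lt')))
           (partAt-here a n inB (v1-seg 0 ∷ D-seg 0 ∷ []) j (<-trans lt lt'))
           (partAt-here a n inB (v1-seg 0 ∷ D-seg 0 ∷ []) (n ∸ 1) (n∸1<n lt'))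
           ne2
    sep : ∀ i j → toℕ i < toℕ j → Separates n lay i j
    sep i i' lt = toℕ i , n ∸ 1 , toℕ<n i , n∸1<n (toℕ<n i) , (λ e → <-irrefl e (<-≤-trans lt (j≤n∸1 (toℕ<n i')))) ,
      sepY (toℕ i) (toℕ i') (toℕ i <? n ∸ 1) (toℕ i' <? n ∸ 1) lt (toℕ<n i')

  layZb : ∀ j → Dec (j < n ∸ 1) → List Segment
  layZb j (yes _) = v2-seg ∷ B-seg j ∷ v1-seg 1 ∷ D-seg (n ∸ suc (suc j)) ∷ []
  layZb j (no _) = v2-seg ∷ B-seg j ∷ v1-seg 0 ∷ D-seg 0 ∷ []

  atLeast-zBvD : suc v2 ≤ a → a + LB ≤ v1 → suc v1 ≤ c → adjℕ G v1 v2 ≢ adjℕ G a v2 → AtLeast P n n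
  atLeast-zBvD v2a av1 v1c ne = atLeast-layouts P hered PG n lay ord tn sok sep
    where
    lay : Fin n → List Segment
    lay jj = layZb (toℕ jj) (toℕ jj <? n ∸ 1)
    ordZ : ∀ j d → j < n → Ascending 0 (layZb j d) N
    ordZ j (yes p) lt = z≤n , ≤-trans (≤-reflexive (+-comm v2 1)) v2a , ≤-trans (+-monoʳ-≤ a (≤-trans (<⇒≤ lt) nLB)) av1 ,
             ≤-trans (≤-reflexive (+-comm v1 1)) v1c , ≤-trans (+-monoʳ-≤ c (≤-trans (m∸n≤m n (suc (suc j))) nLD)) cN
    ordZ j (no p) lt = z≤n , ≤-trans (≤-reflexive (+-comm v2 1)) v2a , ≤-trans (+-monoʳ-≤ a (≤-trans (<⇒≤ lt) nLB)) av1 ,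
             ≤-trans (≤-reflexive (+-identityʳ v1)) (≤-trans (n≤1+n v1) v1c) , ≤-trans (≤-reflexive (+-identityʳ c)) (≤-trans (m≤m+n c LD) cN)
    ord : ∀ jj → Ascending 0 (lay jj) N
    ord jj = ordZ (toℕ jj) (toℕ jj <? n ∸ 1) (toℕ<n jj)
    tnZ : ∀ j d → j < n → size (layZb j d) ≡ n
    tnZ j (yes p) lt = trans (cong (λ x → suc (j + suc x)) (+-identityʳ _))
      (trans (cong suc (+-suc j _)) (m+[n∸m]≡n (j<n∸1⇒1+j<n n j p)))
    tnZ j (no p) lt = trans (cong suc (+-identityʳ j)) (trans (cong suc (j≡n∸1 lt p)) (1+[n∸1]≡n n j lt))
    tn : ∀ jj → size (lay jj) ≡ n
    tn jj = tnZ (toℕ jj) (toℕ jj <? n ∸ 1) (toℕ<n jj)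
    sokZ : ∀ j d → j < n → Conforms InPart (layZb j d)
    sokZ j (yes p) lt = v2-seg-conforms , B-seg-conforms j (≤-trans (<⇒≤ lt) nLB) , v1-seg-conforms 1 ≤-refl , D-seg-conforms _ (≤-trans (m∸n≤m n (suc (suc j))) nLD) , tt
    sokZ j (no p) lt = v2-seg-conforms , B-seg-conforms j (≤-trans (<⇒≤ lt) nLB) , v1-seg-conforms 0 z≤n , D-seg-conforms 0 z≤n , tt
    sok : ∀ jj → Conforms InPart (lay jj)
    sok jj = sokZ (toℕ jj) (toℕ jj <? n ∸ 1) (toℕ<n jj)
    kB' : ∀ j j' (d' : Dec (j' < n ∸ 1)) → j < j' → partAt (layZb j' d') (suc j) ≡ inB
    kB' j j' (yes _) lt = partAt-2nd v2 1 atV₂ a j' inB _ (suc j) (s≤s z≤n) (s≤s lt)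
    kB' j j' (no _) lt = partAt-2nd v2 1 atV₂ a j' inB _ (suc j) (s≤s z≤n) (s≤s lt)
    k2' : ∀ j' (d' : Dec (j' < n ∸ 1)) → partAt (layZb j' d') 0 ≡ atV₂
    k2' j' (yes _) = refl
    k2' j' (no _) = refl
    sepZ : ∀ j j' (d : Dec (j < n ∸ 1)) (d' : Dec (j' < n ∸ 1)) → j < j' → j' < n →
      shape (partAt (layZb j d) 0) (partAt (layZb j d) (suc j)) ≢ shape (partAt (layZb j' d') 0) (partAt (layZb j' d') (suc j))
    sepZ j j' (no nj) d' lt lt' = ⊥-elim (nj (<-≤-trans lt (j≤n∸1 lt')))
    sepZ j j' (yes pj) d' lt lt' =
      shape-≢ (k2' j (yes pj)) (partAt-3rd v2 1 atV₂ a j inB v1 1 atV₁ (D-seg (n ∸ suc (suc j)) ∷ []) (suc j) ≤-refl (≤-reflexive (cong suc (+-comm 1 j))))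
           (k2' j' d') (kB' j j' d' lt) ne
    sep : ∀ i j → toℕ i < toℕ j → Separates n lay i j
    sep i i' lt = 0 , suc (toℕ i) , ≤-trans (s≤s z≤n) (toℕ<n i) , <-≤-trans (s≤s lt) (toℕ<n i') , (λ ()) ,
      sepZ (toℕ i) (toℕ i') (toℕ i <? n ∸ 1) (toℕ i' <? n ∸ 1) lt (toℕ<n i')

  layZa : ∀ j → Dec (j < n ∸ 1) → List Segment
  layZa j (yes _) = B-seg j ∷ v1-seg 1 ∷ D-seg (n ∸ suc (suc j)) ∷ v2-seg ∷ []
  layZa j (no _) = B-seg j ∷ v1-seg 0 ∷ D-seg 0 ∷ v2-seg ∷ []

  atLeast-BvDz : a + LB ≤ v1 → suc v1 ≤ c → c + LD ≤ v2 → suc v2 ≤ N → adjℕ G v1 v2 ≢ adjℕ G a v2 → AtLeast P n n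
  atLeast-BvDz av1 v1c cv2 v2N ne = atLeast-layouts P hered PG n lay ord tn sok sep
    where
    lay : Fin n → List Segment
    lay jj = layZa (toℕ jj) (toℕ jj <? n ∸ 1)
    ordZ : ∀ j d → j < n → Ascending 0 (layZa j d) N
    ordZ j (yes p) lt = z≤n , ≤-trans (+-monoʳ-≤ a (≤-trans (<⇒≤ lt) nLB)) av1 ,
             ≤-trans (≤-reflexive (+-comm v1 1)) v1c , ≤-trans (+-monoʳ-≤ c (≤-trans (m∸n≤m n (suc (suc j))) nLD)) cv2 ,
             ≤-trans (≤-reflexive (+-comm v2 1)) v2N
    ordZ j (no p) lt = z≤n , ≤-trans (+-monoʳ-≤ a (≤-trans (<⇒≤ lt) nLB)) av1 ,
             ≤-trans (≤-reflexive (+-identityʳ v1)) (≤-trans (n≤1+n v1) v1c) , ≤-trans (≤-reflexive (+-identityʳ c)) (≤-trans (m≤m+n c LD) cv2) ,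
             ≤-trans (≤-reflexive (+-comm v2 1)) v2N
    ord : ∀ jj → Ascending 0 (lay jj) N
    ord jj = ordZ (toℕ jj) (toℕ jj <? n ∸ 1) (toℕ<n jj)
    tnZ : ∀ j d → j < n → size (layZa j d) ≡ n
    tnZ j (yes p) lt = trans (+-suc j _) (trans (cong suc (trans (cong (j +_) (+-comm (n ∸ suc (suc j)) 1)) (+-suc j _)))
                        (m+[n∸m]≡n (j<n∸1⇒1+j<n n j p)))
    tnZ j (no p) lt = trans (+-comm j 1) (trans (cong suc (j≡n∸1 lt p)) (1+[n∸1]≡n n j lt))
    tn : ∀ jj → size (lay jj) ≡ n
    tn jj = tnZ (toℕ jj) (toℕ jj <? n ∸ 1) (toℕ<n jj)
    sokZ : ∀ j d → j < n → Conforms InPart (layZa j d)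
    sokZ j (yes p) lt = B-seg-conforms j (≤-trans (<⇒≤ lt) nLB) , v1-seg-conforms 1 ≤-refl , D-seg-conforms _ (≤-trans (m∸n≤m n (suc (suc j))) nLD) , v2-seg-conforms , tt
    sokZ j (no p) lt = B-seg-conforms j (≤-trans (<⇒≤ lt) nLB) , v1-seg-conforms 0 z≤n , D-seg-conforms 0 z≤n , v2-seg-conforms , tt
    sok : ∀ jj → Conforms InPart (lay jj)
    sok jj = sokZ (toℕ jj) (toℕ jj <? n ∸ 1) (toℕ<n jj)
    kq : ∀ j' (d' : Dec (j' < n ∸ 1)) → j' < n → partAt (layZa j' d') (n ∸ 1) ≡ atV₂
    kq j' (yes p) lt = partAt-4th a j' inB v1 1 atV₁ c (n ∸ suc (suc j')) inD v2 1 atV₂ [] (n ∸ 1) (≤-reflexive (j+1+[n∸2∸j]≡n∸1 p))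
      (subst (n ∸ 1 <_) (sym (cong (_+ 1) (j+1+[n∸2∸j]≡n∸1 p))) (≤-reflexive (+-comm 1 (n ∸ 1))))
    kq j' (no p) lt = partAt-4th a j' inB v1 0 atV₁ c 0 inD v2 1 atV₂ [] (n ∸ 1) (≤-reflexive (trans (+-identityʳ _) (trans (+-identityʳ j') (j≡n∸1 lt p))))
      (subst (n ∸ 1 <_) (cong (_+ 1) (sym (trans (+-identityʳ _) (trans (+-identityʳ j') (j≡n∸1 lt p))))) (≤-reflexive (+-comm 1 (n ∸ 1))))
    kj : ∀ j j' (d' : Dec (j' < n ∸ 1)) → j < j' → partAt (layZa j' d') j ≡ inB
    kj j j' (yes _) lt = partAt-here a j' inB _ j lt
    kj j j' (no _) lt = partAt-here a j' inB _ j lt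
    sepZ : ∀ j j' (d : Dec (j < n ∸ 1)) (d' : Dec (j' < n ∸ 1)) → j < j' → j' < n →
      shape (partAt (layZa j d) j) (partAt (layZa j d) (n ∸ 1)) ≢ shape (partAt (layZa j' d') j) (partAt (layZa j' d') (n ∸ 1))
    sepZ j j' (no nj) d' lt lt' = ⊥-elim (nj (<-≤-trans lt (j≤n∸1 lt')))
    sepZ j j' (yes pj) d' lt lt' =
      shape-≢ (partAt-2nd a j inB v1 1 atV₁ (D-seg (n ∸ suc (suc j)) ∷ v2-seg ∷ []) j ≤-refl (≤-reflexive (+-comm 1 j)))
           (kq j (yes pj) (<-trans lt lt')) (kj j j' d' lt) (kq j' d' lt') ne
    sep : ∀ i j → toℕ i < toℕ j → Separates n lay i j
    sep i i' lt = toℕ i , n ∸ 1 , toℕ<n i , n∸1<n (toℕ<n i) , (λ e → <-irrefl e (<-≤-trans lt (j≤n∸1 (toℕ<n i')))) ,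
      sepZ (toℕ i) (toℕ i') (toℕ i <? n ∸ 1) (toℕ i' <? n ∸ 1) lt (toℕ<n i')

  layZg : ∀ j → Dec (j < n ∸ 1) → List Segment
  layZg j (yes _) = B-seg j ∷ v1-seg 1 ∷ v2-seg ∷ D-seg (n ∸ suc (suc j)) ∷ []
  layZg j (no _) = B-seg j ∷ v1-seg 0 ∷ v2-seg ∷ D-seg 0 ∷ []

  module ZG (av1 : a + LB ≤ v1) (v1v2 : suc v1 ≤ v2) (v2c : suc v2 ≤ c) where
    lay : Fin n → List Segment
    lay jj = layZg (toℕ jj) (toℕ jj <? n ∸ 1)
    ordZ : ∀ j d → j < n → Ascending 0 (layZg j d) N
    ordZ j (yes p) lt = z≤n , ≤-trans (+-monoʳ-≤ a (≤-trans (<⇒≤ lt) nLB)) av1 ,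
             ≤-trans (≤-reflexive (+-comm v1 1)) v1v2 , ≤-trans (≤-reflexive (+-comm v2 1)) v2c ,
             ≤-trans (+-monoʳ-≤ c (≤-trans (m∸n≤m n (suc (suc j))) nLD)) cN
    ordZ j (no p) lt = z≤n , ≤-trans (+-monoʳ-≤ a (≤-trans (<⇒≤ lt) nLB)) av1 ,
             ≤-trans (≤-reflexive (+-identityʳ v1)) (≤-trans (n≤1+n v1) v1v2) , ≤-trans (≤-reflexive (+-comm v2 1)) v2c ,
             ≤-trans (≤-reflexive (+-identityʳ c)) (≤-trans (m≤m+n c LD) cN)
    ord : ∀ jj → Ascending 0 (lay jj) N
    ord jj = ordZ (toℕ jj) (toℕ jj <? n ∸ 1) (toℕ<n jj)
    tnZ : ∀ j d → j < n → size (layZg j d) ≡ n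
    tnZ j (yes p) lt = trans (cong (λ x → j + suc (suc x)) (+-identityʳ _))
      (trans (+-suc j _) (trans (cong suc (+-suc j _)) (m+[n∸m]≡n (j<n∸1⇒1+j<n n j p))))
    tnZ j (no p) lt = trans (+-comm j 1) (trans (cong suc (j≡n∸1 lt p)) (1+[n∸1]≡n n j lt))
    tn : ∀ jj → size (lay jj) ≡ n
    tn jj = tnZ (toℕ jj) (toℕ jj <? n ∸ 1) (toℕ<n jj)
    sokZ : ∀ j d → j < n → Conforms InPart (layZg j d)
    sokZ j (yes p) lt = B-seg-conforms j (≤-trans (<⇒≤ lt) nLB) , v1-seg-conforms 1 ≤-refl , v2-seg-conforms , D-seg-conforms _ (≤-trans (m∸n≤m n (suc (suc j))) nLD) , tt
    sokZ j (no p) lt = B-seg-conforms j (≤-trans (<⇒≤ lt) nLB) , v1-seg-conforms 0 z≤n , v2-seg-conforms , D-seg-conforms 0 z≤n , tt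
    sok : ∀ jj → Conforms InPart (lay jj)
    sok jj = sokZ (toℕ jj) (toℕ jj <? n ∸ 1) (toℕ<n jj)
    kj : ∀ j j' (d' : Dec (j' < n ∸ 1)) → j < j' → partAt (layZg j' d') j ≡ inB
    kj j j' (yes _) lt = partAt-here a j' inB _ j lt
    kj j j' (no _) lt = partAt-here a j' inB _ j lt
    k1j : ∀ j → (pj : j < n ∸ 1) → partAt (layZg j (yes pj)) j ≡ atV₁
    k1j j pj = partAt-2nd a j inB v1 1 atV₁ (v2-seg ∷ D-seg (n ∸ suc (suc j)) ∷ []) j ≤-refl (≤-reflexive (+-comm 1 j))
    k2j : ∀ j → (pj : j < n ∸ 1) → partAt (layZg j (yes pj)) (suc j) ≡ atV₂
    k2j j pj = partAt-3rd a j inB v1 1 atV₁ v2 1 atV₂ (D-seg (n ∸ suc (suc j)) ∷ []) (suc j) (≤-reflexive (+-comm j 1))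
                 (≤-reflexive (sym (trans (+-assoc j 1 1) (+-comm j 2))))

    atLeast-BvzD : adjℕ G v1 v2 ≢ tB → adjℕ G v1 v2 ≢ adjℕ G a v1 → adjℕ G v1 v2 ≢ adjℕ G a v2 → AtLeast P n n
    atLeast-BvzD n1 n2 n3 = atLeast-layouts P hered PG n lay ord tn sok sep
      where
      sepZ : ∀ j j' (d : Dec (j < n ∸ 1)) (d' : Dec (j' < n ∸ 1)) → j < j' → j' < n →
        shape (partAt (layZg j d) j) (partAt (layZg j d) (suc j)) ≢ shape (partAt (layZg j' d') j) (partAt (layZg j' d') (suc j))
      sepZ j j' (no nj) d' lt lt' = ⊥-elim (nj (<-≤-trans lt (j≤n∸1 lt')))
      sepZ j j' (yes pj) d' lt lt' with m≤n⇒m<n∨m≡n lt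
      ... | inj₁ lt2 = shape-≢ (k1j j pj) (k2j j pj) (kj j j' d' lt) (kj (suc j) j' d' lt2) n1
      ... | inj₂ refl with d'
      ...   | yes pj' = shape-≢ (k1j j pj) (k2j j pj) (partAt-here a (suc j) inB _ j (n<1+n j))
                          (partAt-2nd a (suc j) inB v1 1 atV₁ (v2-seg ∷ D-seg (n ∸ suc (suc (suc j))) ∷ []) (suc j) ≤-refl (≤-reflexive (+-comm 1 (suc j)))) n2
      ...   | no nj' = shape-≢ (k1j j pj) (k2j j pj) (partAt-here a (suc j) inB _ j (n<1+n j))
                          (partAt-3rd a (suc j) inB v1 0 atV₁ v2 1 atV₂ (D-seg 0 ∷ []) (suc j) (≤-reflexive (+-identityʳ _))
                             (≤-reflexive (trans (+-comm 1 (suc j)) (cong (_+ 1) (sym (+-identityʳ (suc j))))))) n3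
      sep : ∀ i j → toℕ i < toℕ j → Separates n lay i j
      sep i i' lt = toℕ i , suc (toℕ i) , toℕ<n i , <-≤-trans (s≤s lt) (toℕ<n i') , (λ e → <-irrefl e (n<1+n _)) ,
        sepZ (toℕ i) (toℕ i') (toℕ i <? n ∸ 1) (toℕ i' <? n ∸ 1) lt (toℕ<n i')

    zp : ∀ j' → Dec (j' < n ∸ 1) → ℕ
    zp j' (yes _) = suc j'
    zp j' (no _) = j'

    atLeast-BvzD′ : adjℕ G v1 v2 ≢ adjℕ G a v2 → adjℕ G c v1 ≢ adjℕ G a v2 → AtLeast P n n
    atLeast-BvzD′ n1 n2 = atLeast-layouts P hered PG n lay ord tn sok sep
      where
      kq' : ∀ j' (d' : Dec (j' < n ∸ 1)) → partAt (layZg j' d') (zp j' d') ≡ atV₂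
      kq' j' (yes p) = partAt-3rd a j' inB v1 1 atV₁ v2 1 atV₂ (D-seg (n ∸ suc (suc j')) ∷ []) (suc j') (≤-reflexive (+-comm j' 1))
                 (≤-reflexive (sym (trans (+-assoc j' 1 1) (+-comm j' 2))))
      kq' j' (no p) = partAt-3rd a j' inB v1 0 atV₁ v2 1 atV₂ (D-seg 0 ∷ []) j' (≤-reflexive (+-identityʳ _))
                 (≤-reflexive (trans (+-comm 1 j') (cong (_+ 1) (sym (+-identityʳ j')))))
      zpge : ∀ j' d' → j' ≤ zp j' d'
      zpge j' (yes _) = n≤1+n j'
      zpge j' (no _) = ≤-refl
      zp<n : ∀ j' d' → j' < n → zp j' d' < n
      zp<n j' (yes p) lt = j<n∸1⇒1+j<n n j' p
      zp<n j' (no p) lt = lt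
      sepZ : ∀ j j' (d : Dec (j < n ∸ 1)) (d' : Dec (j' < n ∸ 1)) → j < j' → j' < n →
        shape (partAt (layZg j d) j) (partAt (layZg j d) (zp j' d')) ≢ shape (partAt (layZg j' d') j) (partAt (layZg j' d') (zp j' d'))
      sepZ j j' (no nj) d' lt lt' = ⊥-elim (nj (<-≤-trans lt (j≤n∸1 lt')))
      sepZ j j' (yes pj) d' lt lt' with zp j' d' ≟ suc j
      ... | yes eq = shape-≢ (k1j j pj) (trans (cong (partAt (layZg j (yes pj))) eq) (k2j j pj)) (kj j j' d' lt) (kq' j' d') n1
      ... | no neq = shape-≢ (k1j j pj)
              (partAt-4th a j inB v1 1 atV₁ v2 1 atV₂ c (n ∸ suc (suc j)) inD [] (zp j' d')
                 (≤-trans (≤-reflexive (trans (+-assoc j 1 1) (+-comm j 2))) (≤∧≢⇒< (≤-trans lt (zpge j' d')) (λ e → neq (sym e))))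
                 (subst (zp j' d' <_) (sym (trans (cong (_+ (n ∸ suc (suc j))) (trans (+-assoc j 1 1) (+-comm j 2))) (m+[n∸m]≡n (j<n∸1⇒1+j<n n j pj))))
                    (zp<n j' d' lt')))
              (kj j j' d' lt) (kq' j' d') n2
      sep : ∀ i j → toℕ i < toℕ j → Separates n lay i j
      sep i i' lt = toℕ i , zp (toℕ i') (toℕ i' <? n ∸ 1) , toℕ<n i , zp<n _ (toℕ i' <? n ∸ 1) (toℕ<n i') ,
        (λ e → <-irrefl e (<-≤-trans lt (zpge _ (toℕ i' <? n ∸ 1)))) ,
        sepZ (toℕ i) (toℕ i') (toℕ i <? n ∸ 1) (toℕ i' <? n ∸ 1) lt (toℕ<n i')

end∉ : ∀ {N} (G : OGraph N) a L → HomInterval G a L → ¬ Within a L N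
end∉ G a L (bnd , _) (_ , lt) = <-irrefl refl (<-≤-trans lt bnd)

-- With e the adjacency between B and D and tB, tD the adjacency inside B and D:
-- if e ≢ tB or e ≢ tD, initial segments of B and D suffice. Otherwise, a vertex
-- outside B ∪ D telling B from D yields a family with one extra vertex. If there
-- is none, the separator z of B rules out that the vertex R after B lies in D,
-- and R, possibly together with z, yields the remaining families.
module TwoBlockCases (P : Property) (hered : Hereditary P) {N : ℕ} (G : OGraph N) (PG : P G) (n : ℕ)
  (b : Fin 2 → ℕ × ℕ) (binj : ∀ i j → b i ≡ b j → i ≡ j)
  (bprop : ∀ i → HomBlock G (proj₁ (b i)) (proj₂ (b i)) × n + 3 ≤ proj₂ (b i)) where

  open Blocks G 1 n b binj bprop
  Bi : Fin 2
  Bi = σ fz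
  Di : Fin 2
  Di = d
  A : ℕ
  A = a Bi
  LB : ℕ
  LB = l Bi
  Cc : ℕ
  Cc = a Di
  LD : ℕ
  LD = l Di
  R : ℕ
  R = A + LB
  disj : ∀ v → Within A LB v → Within Cc LD v → ⊥
  disj v vb vd = σ≢d fz (block-unique Bi Di v vb vd)
  nL : ∀ i → n ≤ l i
  nL i = ≤-trans (m≤m+n n 3) (n+3≤l i)
  rc : R ≤ Cc
  rc = r≤ad fz
  W : Separator fz
  W = separator fz
  z : ℕ
  z = Separator.z W
  module Families (v1 v2 : ℕ) (v1B : ¬ Within A LB v1) (v1D : ¬ Within Cc LD v1) (v2B : ¬ Within A LB v2) (v2D : ¬ Within Cc LD v2) =
    TwoBlockFamilies G n A LB Cc LD v1 v2 (homogeneous Bi) (homogeneous Di) (2≤l Bi) (2≤l Di) disj v1B v1D v2B v2D (nL Bi) (nL Di) rc (end≤N Di) P hered PG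
  module Shapes = TwoBlocks G A LB Cc LD N N (homogeneous Bi) (homogeneous Di) (2≤l Bi) (2≤l Di) disj (end∉ G A LB (homogeneous Bi)) (end∉ G Cc LD (homogeneous Di)) (end∉ G A LB (homogeneous Bi)) (end∉ G Cc LD (homogeneous Di))
  open Shapes using (tB; tD; e; adj-B-outside; adj-D-outside; adj-B-D; aB; saB; cD)

  module FamiliesBD = Families N N (end∉ G A LB (homogeneous Bi)) (end∉ G Cc LD (homogeneous Di)) (end∉ G A LB (homogeneous Bi)) (end∉ G Cc LD (homogeneous Di))

  data Place (w : ℕ) : Set where
    before : suc w ≤ A → Place w
    between : R ≤ w → suc w ≤ Cc → Place w
    after : Cc + LD ≤ w → Place w

  place : ∀ w → ¬ Within A LB w → ¬ Within Cc LD w → Place w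
  place w nb nd with w <? A
  ... | yes lt = before lt
  ... | no ge with w <? Cc
  ...   | yes lt = between (≮⇒≥ (λ lt' → nb (≮⇒≥ ge , lt'))) lt
  ...   | no ge' = after (≮⇒≥ (λ lt' → nd (≮⇒≥ ge' , lt')))

  R∉B : ¬ Within A LB R
  R∉B (_ , lt) = <-irrefl refl lt

  module B-D-alike (te : tB ≡ e) (et : e ≡ tD)
    (alike-outside : ∀ w → ¬ Within A LB w → ¬ Within Cc LD w → adjℕ G A w ≡ adjℕ G Cc w) where
    A+1<R : suc A < R
    A+1<R = proj₂ saB
    z-separates : adjℕ G (suc A) z ≢ adjℕ G R z
    z-separates = Separator.separates W (suc A) ≤-refl A+1<R
    z∈B⇒z≡A : Within A LB z → z ≡ A
    z∈B⇒z≡A z∈B = zi (z ≟ A)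
      where
      zi : Dec (z ≡ A) → z ≡ A
      zi (yes eq) = eq
      zi (no ne) = ⊥-elim (Separator.∉own W (≤∧≢⇒< (proj₁ z∈B) (λ eq → ne (sym eq)) , proj₂ z∈B))
    sA≢A : suc A ≢ A
    sA≢A eq = <-irrefl (sym eq) (n<1+n A)
    z≡A⇒adj≡tB : z ≡ A → adjℕ G (suc A) z ≡ tB
    z≡A⇒adj≡tB eq = trans (cong (adjℕ G (suc A)) eq) (Shapes.adj-shape inB inB (suc A) A saB aB sA≢A)
    R∉D : ¬ Within Cc LD R
    R∉D iR = by-z∈B? (within? A LB z)
      where
      by-z∈B? : Dec (Within A LB z) → ⊥
      by-z∈B? (yes z∈B) = z-separates (trans (z≡A⇒adj≡tB (z∈B⇒z≡A z∈B)) (trans te (sym (trans (cong (adjℕ G R) (z∈B⇒z≡A z∈B)) (trans (adjℕ-sym G R A) (adj-B-D A R aB iR))))))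
      by-z∈B? (no z∉B) = by-z∈D? (within? Cc LD z)
        where
        by-z∈D? : Dec (Within Cc LD z) → ⊥
        by-z∈D? (yes z∈D) = z-separates (trans (adj-B-D (suc A) z saB z∈D) (trans et (sym (Shapes.adj-shape inD inD R z iR z∈D (λ eq → Separator.zr W (sym eq))))))
        by-z∈D? (no z∉D) = z-separates (trans (adj-B-outside (suc A) z saB z∉B) (trans (alike-outside z z∉B z∉D) (sym (adj-D-outside R z iR z∉D))))
    R<Cc : suc R ≤ Cc
    R<Cc = ≤∧≢⇒< rc (λ eq → R∉D (subst (Within Cc LD) (sym eq) cD))
    AR≡CcR : adjℕ G A R ≡ adjℕ G Cc R
    AR≡CcR = alike-outside R R∉B R∉D
    by-A∼R : AtLeast P n n
    by-A∼R = by-A∼R? (adjℕ G A R ≟B tB)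
      where
      by-A∼R? : Dec (adjℕ G A R ≡ tB) → AtLeast P n n
      by-A∼R? (no ne) = Families.atLeast-BvD R N R∉B R∉D (end∉ G A LB (homogeneous Bi)) (end∉ G Cc LD (homogeneous Di)) ≤-refl R<Cc
                    (λ eq → ne (trans AR≡CcR (trans eq (sym te)))) (λ eq → ne (trans AR≡CcR eq))
      by-A∼R? (yes sr) = by-place-of-z (place z z∉B z∉D)
        where
        z∉B : ¬ Within A LB z
        z∉B iz = z-separates (trans (z≡A⇒adj≡tB (z∈B⇒z≡A iz)) (sym (trans (cong (adjℕ G R) (z∈B⇒z≡A iz)) (trans (adjℕ-sym G R A) sr))))
        z∉D : ¬ Within Cc LD z
        z∉D iz = z-separates (trans (adj-B-D (suc A) z saB iz) (sym (trans (adjℕ-sym G R z) (trans (adj-D-outside z R iz R∉D) (trans (sym AR≡CcR) (trans sr te))))))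
        z-separates-R-A : adjℕ G R z ≢ adjℕ G A z
        z-separates-R-A eq = z-separates (trans (adj-B-outside (suc A) z saB z∉B) (sym eq))
        by-place-of-z : Place z → AtLeast P n n
        by-place-of-z (before lt) = Families.atLeast-zBvD R z R∉B R∉D z∉B z∉D lt ≤-refl R<Cc z-separates-R-A
        by-place-of-z (after le) = Families.atLeast-BvDz R z R∉B R∉D z∉B z∉D ≤-refl R<Cc le (Separator.z<N W) z-separates-R-A
        by-place-of-z (between r≤ lt) = by-tB≟Az (tB ≟B adjℕ G A z)
          where
          R<z : suc R ≤ z
          R<z = ≤∧≢⇒< r≤ (λ eq → Separator.zr W (sym eq))
          by-tB≟Az : Dec (tB ≡ adjℕ G A z) → AtLeast P n n
          by-tB≟Az (yes tz) = Families.ZG.atLeast-BvzD R z R∉B R∉D z∉B z∉D ≤-refl R<z lt (λ eq → z-separates-R-A (trans eq tz))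
                         (λ eq → z-separates-R-A (trans eq (trans sr tz))) z-separates-R-A
          by-tB≟Az (no tz) = Families.ZG.atLeast-BvzD′ R z R∉B R∉D z∉B z∉D ≤-refl R<z lt z-separates-R-A (λ eq → tz (trans (sym sr) (trans AR≡CcR eq)))

  distinguishes? : (w : Fin N) → Dec (¬ Within A LB (toℕ w) × ¬ Within Cc LD (toℕ w) × adjℕ G A (toℕ w) ≢ adjℕ G Cc (toℕ w))
  distinguishes? w = ¬? (within? A LB (toℕ w)) ×-dec (¬? (within? Cc LD (toℕ w)) ×-dec ¬? (adjℕ G A (toℕ w) ≟B adjℕ G Cc (toℕ w)))

  alike-outside-if-none : ¬ (∃ λ (w : Fin N) → ¬ Within A LB (toℕ w) × ¬ Within Cc LD (toℕ w) × adjℕ G A (toℕ w) ≢ adjℕ G Cc (toℕ w)) →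
    ∀ w → ¬ Within A LB w → ¬ Within Cc LD w → adjℕ G A w ≡ adjℕ G Cc w
  alike-outside-if-none none w nb nd = go (w <? N)
    where
    go : Dec (w < N) → adjℕ G A w ≡ adjℕ G Cc w
    go (no ge) = trans (adjℕ-outʳ G A w (≮⇒≥ ge)) (sym (adjℕ-outʳ G Cc w (≮⇒≥ ge)))
    go (yes lt) = go2 (adjℕ G A w ≟B adjℕ G Cc w)
      where
      go2 : Dec (adjℕ G A w ≡ adjℕ G Cc w) → adjℕ G A w ≡ adjℕ G Cc w
      go2 (yes eq) = eq
      go2 (no ne) = ⊥-elim (none (fromℕ< lt , subst (λ v → ¬ Within A LB v) (sym (toℕ-fromℕ< lt)) nb ,
                        subst (λ v → ¬ Within Cc LD v) (sym (toℕ-fromℕ< lt)) nd ,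
                        subst (λ v → adjℕ G A v ≢ adjℕ G Cc v) (sym (toℕ-fromℕ< lt)) ne))

  case-tB≡e≡tD : tB ≡ e → e ≡ tD → AtLeast P n n
  case-tB≡e≡tD te et = by-distinguisher? (any? distinguishes?)
    where
    by-distinguisher? : Dec (∃ λ w → ¬ Within A LB (toℕ w) × ¬ Within Cc LD (toℕ w) × adjℕ G A (toℕ w) ≢ adjℕ G Cc (toℕ w)) → AtLeast P n n
    by-distinguisher? (yes (w , nb , nd , ne)) = by-place-of-w (place (toℕ w) nb nd)
      where
      by-place-of-w : Place (toℕ w) → AtLeast P n n
      by-place-of-w (before lt) = Families.atLeast-wBD (toℕ w) N nb nd (end∉ G A LB (homogeneous Bi)) (end∉ G Cc LD (homogeneous Di)) lt (λ eq → ne (sym eq))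
      by-place-of-w (between r≤ lt) = Families.atLeast-BwD (toℕ w) N nb nd (end∉ G A LB (homogeneous Bi)) (end∉ G Cc LD (homogeneous Di)) r≤ lt (λ eq → ne (sym eq))
      by-place-of-w (after le) = Families.atLeast-BDw (toℕ w) N nb nd (end∉ G A LB (homogeneous Bi)) (end∉ G Cc LD (homogeneous Di)) le (toℕ<n w) (λ eq → ne (sym eq))
    by-distinguisher? (no none) = B-D-alike.by-A∼R te et (alike-outside-if-none none)

  atLeast-n : AtLeast P n n
  atLeast-n = by-e≟tB (e ≟B tB)
    where
    by-e≟tB : Dec (e ≡ tB) → AtLeast P n n
    by-e≟tB (no ne) = FamiliesBD.atLeast-BD⁺ ne
    by-e≟tB (yes et) = by-e≟tD (e ≟B tD)
      where
      by-e≟tD : Dec (e ≡ tD) → AtLeast P n n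
      by-e≟tD (no ne) = FamiliesBD.atLeast-BD (λ eq → ne (sym eq))
      by-e≟tD (yes ed) = case-tB≡e≡tD (sym et) ed

atLeast-n-from-twoBlocks : (P : Property) → Hereditary P → ∀ {N} (G : OGraph N) → P G → ∀ n →
  tGeq G 1 (n + 3) → AtLeast P n n
atLeast-n-from-twoBlocks P hered G PG n (b , binj , bprop) = TwoBlockCases.atLeast-n P hered G PG n b binj bprop

UnboundedBlocks : Property → ℕ → Set
UnboundedBlocks P k = ∀ M → Σ ℕ λ n → Σ (OGraph n) λ G → P G × tGeq G k M

4k+2≡3k+2+k : ∀ k → 2 + k * 4 ≡ 3 * k + 2 + k
4k+2≡3k+2+k = solve 1 (λ k → con 2 :+ k :* con 4 := con 3 :* k :+ con 2 :+ k) refl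
  where open +-*-Solver

n∸[3k+2]≡n∸[4k+2]+k : ∀ k n → 2 + k * 4 ≤ n → n ∸ (3 * k + 2) ≡ n ∸ (2 + k * 4) + k
n∸[3k+2]≡n∸[4k+2]+k k n le = trans (cong (_∸ A) n≡T+k+A) (m+n∸n≡m (T + k) A)
  where
  A : ℕ
  A = 3 * k + 2
  T : ℕ
  T = n ∸ (2 + k * 4)
  n≡T+k+A : n ≡ T + k + A
  n≡T+k+A = trans (sym (m∸n+n≡m le)) (trans (cong (T +_) (trans (4k+2≡3k+2+k k) (+-comm A k))) (sym (+-assoc T k A)))

n∸A<k : ∀ n A k → 0 < k → n < A + k → n ∸ A < k
n∸A<k n A k 0<k lt with n ≤? A
... | yes le = subst (_< k) (sym (m≤n⇒m∸n≡0 le)) 0<k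
... | no gt = subst (n ∸ A <_) (m+n∸m≡n A k) (∸-monoˡ-< lt (<⇒≤ (≰⇒> gt)))

atLeast-0 : ∀ (P : Property) n → AtLeast P n 0
atLeast-0 P n = (λ ()) , (λ ()) , λ ()

atLeast-1 : ∀ (P : Property) → Hereditary P → UnboundedBlocks P 0 → ∀ n → AtLeast P n 1
atLeast-1 P hered hyp n with hyp n
... | (N , G , PG , (b , _ , bprop)) = (λ _ → induced G f f-increasing) , (λ _ → proj₂ hered G f f-increasing PG) , λ { fz fz ne _ → ne refl }
  where
  n≤N : n ≤ N
  n≤N = ≤-trans (proj₂ (bprop fz)) (≤-trans (m≤n+m _ (proj₁ (b fz))) (proj₁ (proj₁ (proj₂ (proj₁ (bprop fz))))))
  f : Fin n → Fin N
  f p = fromℕ< (<-≤-trans (toℕ<n p) n≤N)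
  f-increasing : StrictlyIncreasing f
  f-increasing i j lt = subst₂ _<_ (sym (toℕ-fromℕ< _)) (sym (toℕ-fromℕ< _)) lt

atLeast-[n∸[3k+2]]Ck : ∀ (P : Property) → Hereditary P → ∀ k → UnboundedBlocks P k → ∀ n → AtLeast P n ((n ∸ (3 * k + 2)) C k)
atLeast-[n∸[3k+2]]Ck P hered zero hyp n = atLeast-1 P hered hyp n
atLeast-[n∸[3k+2]]Ck P hered k@(suc _) hyp n with 2 + k * 4 ≤? n | hyp (n + 3)
... | yes le | (N , G , PG , blocks) =
  subst (AtLeast P n) (cong (_C k) (sym (n∸[3k+2]≡n∸[4k+2]+k k n le))) (atLeast-compositions P hered G PG k n blocks le)
... | no gt | _ =
  subst (AtLeast P n) (sym (k>n⇒nCk≡0 (n∸A<k n (3 * k + 2) k (s≤s z≤n) (subst (n <_) (4k+2≡3k+2+k k) (≰⇒> gt)))))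
    (atLeast-0 P n)

atLeast-n : ∀ (P : Property) → Hereditary P → UnboundedBlocks P 1 → ∀ n → AtLeast P n n
atLeast-n P hered hyp n with hyp (n + 3)
... | (N , G , PG , blocks) = atLeast-n-from-twoBlocks P hered G PG n blocks

lemma4p2 : (P : Property) → Hereditary P → (k : ℕ) →
    (∀ M → Σ ℕ λ n → Σ (OGraph n) λ G → P G × tGeq G k M) →
    (∀ n → AtLeast P n ((n ∸ (3 * k + 2)) C k))
    × (Σ ℕ λ c → Σ ℕ λ N → ∀ n → N ≤ n →
         (n ^ k ≤ (k !) * ((n ∸ (3 * k + 2)) C k) + c * n ^ (k ∸ 1))
         × ((k !) * ((n ∸ (3 * k + 2)) C k) ≤ n ^ k + c * n ^ (k ∸ 1)))
    × (k ≡ 1 → ∀ n → AtLeast P n n)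
lemma4p2 P hered k hyp =
  atLeast-[n∸[3k+2]]Ck P hered k hyp , k!*[n∸A]Ck≈n^k (3 * k + 2) k , λ { refl → atLeast-n P hered hyp }
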